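{- Fix a standard Young tableau $T$ of shape $\lambda\vdash k$. For $n\ge k$ let $N(n;T)$ be the number of standard Young tableaux with $n$ cells that contain $T$ as a subtableau, and let $t_n$ be the number of all standard Young tableaux with $n$ cells. Then \[\lim_{n\to\infty}\frac{N(n;T)}{t_n}=\frac{f^{\lambda}}{k!},\] where $f^\lambda$ is the number of standard Young tableaux of shape $\lambda$.
   Context: All tableaux are standard Young tableaux (English convention): a tableau with $n$ cells is a filling of a Ferrers diagram with $n$ cells by $1,2,\dots,n$, each used once, increasing along rows and down columns. A subtableau of a tableau $U$ with $n$ cells is the tableau formed by the cells of $U$ containing the letters $1,2,\dots,k$, for some $k\le n$; thus $U$ contains $T$ (with $k$ cells) as a subtableau iff the cells of $U$ containing $1,\dots,k$ form exactly the tableau $T$. -}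

module Defs where

open import Data.Nat using (ℕ; zero; suc; _<_; _≤?_)
open import Data.Nat.Base using (_!)
open import Data.Integer using (+_)
open import Data.Rational using (ℚ; 0ℚ; _/_)
open import Data.List using (List; []; _∷_; map; concat; upTo; filter; length)
open import Data.List.Relation.Unary.All using (All)
open import Data.List.Relation.Unary.Unique.Propositional using (Unique)
open import Data.List.Relation.Unary.Linked using (Linked)
open import Data.List.Relation.Binary.Permutation.Propositional using (_↭_)
open import Data.List.Membership.Propositional using (_∈_)
open import Data.Product using (Σ; _×_)
open import Data.Unit using (⊤)
open import Data.Empty using (⊥)
open import Function.Bundles using (_⇔_)
open import Relation.Binary.PropositionalEquality using (_≡_)
open import Relation.Nullary using (¬_)
open import Relation.Unary using (Pred)

-- A tableau is given by its list of rows (top row first), each row read left to right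
-- (English convention).
Tableau : Set
Tableau = List (List ℕ)

ColInc : List ℕ → List ℕ → Set
ColInc _        []       = ⊤
ColInc []       (_ ∷ _)  = ⊥
ColInc (a ∷ as) (b ∷ bs) = (a < b) × ColInc as bs

NonEmpty : List ℕ → Set
NonEmpty [] = ⊥
NonEmpty (_ ∷ _) = ⊤

-- U is a standard Young tableau with n cells: all rows are nonempty, rows strictly
-- increase, consecutive rows satisfy ColInc (so row lengths weakly decrease, i.e. the
-- shape is a Ferrers diagram, and columns strictly increase), and the entries are
-- exactly 1, 2, ..., n, each used once.
record IsSYT (n : ℕ) (U : Tableau) : Set where
  field
    rowsNonEmpty : All NonEmpty U
    rowsInc      : All (Linked _<_) U
    colsInc      : Linked ColInc U
    entries      : concat U ↭ map suc (upTo n)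

shape : Tableau → List ℕ
shape U = map length U

restrict : ℕ → Tableau → Tableau
restrict k U = filter (λ r → Data.Nat._≤?_ 1 (length r)) (map (filter (λ x → x ≤? k)) U)

ContainsSub : ℕ → Tableau → Tableau → Set
ContainsSub k T U = restrict k U ≡ T

HasCount : Pred Tableau _ → ℕ → Set
HasCount P m = Σ (List Tableau) λ L → (length L ≡ m) × Unique L × (∀ U → P U ⇔ (U ∈ L))

-- a / b as a rational number (b is always nonzero where used; value 0 if b = 0).
ratio : ℕ → ℕ → ℚ
ratio a zero    = 0ℚ
ratio a (suc b) = + a / suc b

module Submission where

-- A standard tableau with n cells containing T amounts to a path of length n − k upwards from
-- the shape λ of T in Young's lattice, so N(n;T) = paths (n − k) λ and t_n = paths n ∅, while
-- f^λ counts the paths from ∅ to λ.  Because Young's lattice is 1-differential (DU = UD + I),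
--   paths (m + 2) σ = paths (m + 1) σ + (m + 1) paths m σ + Σ_{σ⁻ ⋖ σ} paths (m + 1) σ⁻,
-- the recurrence t_{m+2} = t_{m+1} + (m + 1) t_m of the involution numbers plus a forcing term.
-- By induction on |σ| = k, and since f^σ = Σ_{σ⁻ ⋖ σ} f^{σ⁻}, the forcing term is asymptotic
-- to k (f^σ / k!) t_{m+k}; comparing solutions of the recurrence then gives
-- paths m σ / t_{m+k} → f^σ / k!.

open import Defs

-- A module of its own, so that ℕ's _<_ is not in scope at theorem1, which uses ℚ's.
module YoungLattice where

  open import Data.Bool using (true; false; if_then_else_)
  open import Data.Empty using (⊥-elim)
  open import Data.Integer as ℤ using (_⊖_)
  import Data.Integer.Properties as ℤ
  open import Data.List using (List; []; _∷_; _++_; _∷ʳ_; length; map; filter; upTo; applyUpTo; concat; concatMap)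
  open import Data.List.Properties
    using (≡-dec; ++-assoc; ++-identityʳ; map-++; map-∘; map-cong; length-map; length-++; length-upTo; upTo-∷ʳ;
           filter-all; filter-++; filter-accept; filter-reject; filter-none)
  open import Data.List.Membership.Propositional using (_∈_; _∉_; find; lose)
  open import Data.List.Membership.Propositional.Properties
    using (∈-map⁺; ∈-map⁻; ∈-upTo⁺; ∈-upTo⁻; ∈-++⁺ʳ; ∈-++⁻; ∈-filter⁺; ∈-filter⁻;
           ∈-concatMap⁺; ∈-concatMap⁻)
  open import Data.List.Membership.Propositional.Properties.WithK using (unique∧set⇒bag)
  open import Data.List.Relation.Binary.BagAndSetEquality using (∼bag⇒↭)
  open import Data.List.Relation.Binary.Permutation.Propositional
    using (_↭_; ↭-refl; ↭-sym; ↭-trans; ↭-reflexive; ↭⇒↭ₛ)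
  open import Data.List.Relation.Binary.Permutation.Propositional.Properties
    using (∈-resp-↭; ↭-length; ++⁺ˡ; ++⁺ʳ; ++-comm; filter-↭)
  import Data.List.Relation.Binary.Permutation.Setoid.Properties as PermutationSetoid
  open import Data.List.Relation.Unary.All as All using (All; []; _∷_)
  import Data.List.Relation.Unary.All.Properties as All
  open import Data.List.Relation.Unary.AllPairs using ([]; _∷_)
  open import Data.List.Relation.Unary.Any using (here; there)
  open import Data.List.Relation.Unary.Linked as Linked using (Linked; []; [-]; _∷_)
  import Data.List.Relation.Unary.Linked.Properties as Linked
  open import Data.List.Relation.Unary.Unique.Propositional using (Unique)
  import Data.List.Relation.Unary.Unique.Propositional.Properties as Unique
  open import Data.Nat
    using (ℕ; zero; suc; pred; _+_; _*_; _∸_; _≤_; _<_; z≤n; s≤s; z<s; s<s; _≟_; _<?_; _≤?_; _⊔_; _!)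
  open import Data.Nat.ListAction using (sum)
  open import Data.Nat.ListAction.Properties using (sum-++)
  open import Data.Nat.Properties
  open import Data.Nat.Tactic.RingSolver using (solve-∀)
  open import Data.List.Membership.DecPropositional _≟_ using (_∈?_)
  open import Data.Product as Product using (Σ; _×_; _,_; proj₁; proj₂)
  open import Data.Rational as ℚ using (mkℚ; 0ℚ; toℚᵘ)
  import Data.Rational.Properties as ℚ
  open import Data.Rational.Unnormalised as ℚᵘ using (mkℚᵘ; *<*)
  import Data.Rational.Unnormalised.Properties as ℚᵘ
  open import Data.Sum using (inj₁; inj₂)
  open import Data.Unit using (⊤; tt)
  open import Function using (_∘_; id)
  open import Function.Bundles using (_⇔_; mk⇔; Equivalence)
  open import Relation.Binary.Definitions using (DecidableEquality)
  open import Relation.Binary.PropositionalEquality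
  open import Relation.Nullary using (Dec; yes; no; ¬_; does)
  open import Relation.Unary using (Pred; Decidable)

  private
    variable
      P P₁ P₂ Q₁ Q₂ : Set

  when : Dec P → ℕ → ℕ
  when d n = if does d then n else 0

  when-holds : (d : Dec P) → P → ∀ n → when d n ≡ n
  when-holds (yes _) _ n = refl
  when-holds (no ¬p) p n = ⊥-elim (¬p p)

  when-fails : (d : Dec P) → ¬ P → ∀ n → when d n ≡ 0
  when-fails (yes p) ¬p n = ⊥-elim (¬p p)
  when-fails (no _) ¬p n = refl

  when-cong : (d : Dec P) {m n : ℕ} → (P → m ≡ n) → when d m ≡ when d n
  when-cong (yes p) m≡n = m≡n p
  when-cong (no _) m≡n = refl

  when-+ : (d : Dec P) (m n : ℕ) → when d (m + n) ≡ when d m + when d n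
  when-+ (yes _) m n = refl
  when-+ (no _) m n = refl

  *-when : (d : Dec P) (c n : ℕ) → c * when d n ≡ when d (c * n)
  *-when (yes _) c n = refl
  *-when (no _) c n = *-zeroʳ c

  when-when : (d₁ : Dec P₁) (d₂ : Dec P₂) (e₁ : Dec Q₁) (e₂ : Dec Q₂) {x y : ℕ} →
    (P₁ → P₂ → Q₁ × Q₂) → (Q₁ → Q₂ → P₁ × P₂) → (P₁ → P₂ → Q₁ → Q₂ → x ≡ y) →
    when d₁ (when d₂ x) ≡ when e₁ (when e₂ y)
  when-when (yes p₁) (yes p₂) e₁ e₂ ⇒Q ⇒P x≡y =
    let q₁ , q₂ = ⇒Q p₁ p₂ in
    trans (x≡y p₁ p₂ q₁ q₂) (sym (trans (when-holds e₁ q₁ _) (when-holds e₂ q₂ _)))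
  when-when (yes _) (no ¬p₂) (yes q₁) (yes q₂) ⇒Q ⇒P x≡y = ⊥-elim (¬p₂ (proj₂ (⇒P q₁ q₂)))
  when-when (yes _) (no _) (yes _) (no _) ⇒Q ⇒P x≡y = refl
  when-when (yes _) (no _) (no _) e₂ ⇒Q ⇒P x≡y = refl
  when-when (no ¬p₁) d₂ (yes q₁) (yes q₂) ⇒Q ⇒P x≡y = ⊥-elim (¬p₁ (proj₁ (⇒P q₁ q₂)))
  when-when (no _) d₂ (yes _) (no _) ⇒Q ⇒P x≡y = refl
  when-when (no _) d₂ (no _) e₂ ⇒Q ⇒P x≡y = refl

  sumBelow : ℕ → (ℕ → ℕ) → ℕ
  sumBelow zero    f = 0
  sumBelow (suc n) f = f 0 + sumBelow n (f ∘ suc)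

  syntax sumBelow n (λ i → e) = ∑[ i < n ] e

  ∑-cong : ∀ n {f g : ℕ → ℕ} → (∀ i → i < n → f i ≡ g i) → sumBelow n f ≡ sumBelow n g
  ∑-cong zero    f≡g = refl
  ∑-cong (suc n) f≡g = cong₂ _+_ (f≡g 0 z<s) (∑-cong n (λ i i<n → f≡g (suc i) (s<s i<n)))

  ∑-zero : ∀ n {f : ℕ → ℕ} → (∀ i → i < n → f i ≡ 0) → sumBelow n f ≡ 0
  ∑-zero zero    f≡0 = refl
  ∑-zero (suc n) {f} f≡0 =
    trans (cong (_+ sumBelow n (f ∘ suc)) (f≡0 0 z<s)) (∑-zero n (λ i i<n → f≡0 (suc i) (s<s i<n)))

  ∑-+ : ∀ n (f g : ℕ → ℕ) → ∑[ i < n ] (f i + g i) ≡ sumBelow n f + sumBelow n g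
  ∑-+ zero    f g = refl
  ∑-+ (suc n) f g = trans (cong (f 0 + g 0 +_) (∑-+ n (f ∘ suc) (g ∘ suc))) (interchange (f 0) (g 0) _ _)
    where
    interchange : ∀ a b c d → (a + b) + (c + d) ≡ (a + c) + (b + d)
    interchange = solve-∀

  ∑-* : ∀ n c (f : ℕ → ℕ) → ∑[ i < n ] (c * f i) ≡ c * sumBelow n f
  ∑-* zero    c f = sym (*-zeroʳ c)
  ∑-* (suc n) c f = trans (cong (c * f 0 +_) (∑-* n c (f ∘ suc))) (sym (*-distribˡ-+ c (f 0) _))

  ∑-split : ∀ m n (f : ℕ → ℕ) → sumBelow (m + n) f ≡ sumBelow m f + ∑[ i < n ] f (m + i)
  ∑-split zero    n f = refl
  ∑-split (suc m) n f = trans (cong (f 0 +_) (∑-split m n (f ∘ suc))) (sym (+-assoc (f 0) _ _))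

  ∑-extend : ∀ {m n} (f : ℕ → ℕ) → m ≤ n → (∀ i → m ≤ i → f i ≡ 0) → sumBelow m f ≡ sumBelow n f
  ∑-extend {m} {n} f m≤n vanish = begin
    sumBelow m f                                ≡⟨ sym (+-identityʳ _) ⟩
    sumBelow m f + 0                            ≡⟨ cong (sumBelow m f +_) (sym tail≡0) ⟩
    sumBelow m f + ∑[ i < n ∸ m ] f (m + i)     ≡⟨ sym (∑-split m (n ∸ m) f) ⟩
    sumBelow (m + (n ∸ m)) f                    ≡⟨ cong (λ k → sumBelow k f) (m+[n∸m]≡n m≤n) ⟩
    sumBelow n f                                ∎
    where
    open ≡-Reasoning
    tail≡0 : ∑[ i < n ∸ m ] f (m + i) ≡ 0
    tail≡0 = ∑-zero (n ∸ m) (λ i _ → vanish (m + i) (m≤m+n m i))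

  ∑-swap : ∀ m n (f : ℕ → ℕ → ℕ) → ∑[ i < m ] ∑[ j < n ] f i j ≡ ∑[ j < n ] ∑[ i < m ] f i j
  ∑-swap zero    n f = sym (∑-zero n (λ _ _ → refl))
  ∑-swap (suc m) n f = trans (cong (sumBelow n (f 0) +_) (∑-swap m n (f ∘ suc)))
                             (sym (∑-+ n (f 0) (λ j → ∑[ i < m ] f (suc i) j)))

  ∑-delta : ∀ n i (g : ℕ → ℕ) → i < n → ∑[ j < n ] when (i ≟ j) (g j) ≡ g i
  ∑-delta (suc n) zero    g _ = trans (cong (g 0 +_) (∑-zero n (λ _ _ → refl))) (+-identityʳ _)
  ∑-delta (suc n) (suc i) g (s≤s i<n) = ∑-delta n i (g ∘ suc) i<n

  when-∑ : (d : Dec P) (n : ℕ) (f : ℕ → ℕ) → when d (sumBelow n f) ≡ ∑[ j < n ] when d (f j)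
  when-∑ (yes _) n f = refl
  when-∑ (no _)  n f = sym (∑-zero n (λ _ _ → refl))

  filter-∷-cong : ∀ {A : Set} {P : A → Set} (P? : Decidable P) x {xs ys} →
    filter P? xs ≡ filter P? ys → filter P? (x ∷ xs) ≡ filter P? (x ∷ ys)
  filter-∷-cong P? x eq with does (P? x)
  ... | true  = cong (x ∷_) eq
  ... | false = eq

  sum-map-filter : ∀ {A : Set} {P : A → Set} (P? : Decidable P) (f : A → ℕ) xs →
    sum (map f (filter P? xs)) ≡ sum (map (λ x → when (P? x) (f x)) xs)
  sum-map-filter P? f []       = refl
  sum-map-filter P? f (x ∷ xs) with does (P? x)
  ... | false = sum-map-filter P? f xs
  ... | true  = cong (f x +_) (sum-map-filter P? f xs)

  sum-map-applyUpTo : ∀ (g f : ℕ → ℕ) n → sum (map f (applyUpTo g n)) ≡ ∑[ i < n ] f (g i)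
  sum-map-applyUpTo g f zero    = refl
  sum-map-applyUpTo g f (suc n) = cong (f (g 0) +_) (sum-map-applyUpTo (g ∘ suc) f n)

  sum-map-concatMap : ∀ {A B : Set} (h : B → ℕ) (f : A → List B) xs →
    sum (map h (concatMap f xs)) ≡ sum (map (λ x → sum (map h (f x))) xs)
  sum-map-concatMap h f []       = refl
  sum-map-concatMap h f (x ∷ xs) = begin
    sum (map h (f x ++ concatMap f xs))                   ≡⟨ cong sum (map-++ h (f x) (concatMap f xs)) ⟩
    sum (map h (f x) ++ map h (concatMap f xs))           ≡⟨ sum-++ (map h (f x)) _ ⟩
    sum (map h (f x)) + sum (map h (concatMap f xs))      ≡⟨ cong (sum (map h (f x)) +_) (sum-map-concatMap h f xs) ⟩
    sum (map h (f x)) + sum (map (λ x → sum (map h (f x))) xs) ∎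
    where open ≡-Reasoning

  length≡sum-map-1 : ∀ {A : Set} (xs : List A) → length xs ≡ sum (map (λ _ → 1) xs)
  length≡sum-map-1 []       = refl
  length≡sum-map-1 (x ∷ xs) = cong suc (length≡sum-map-1 xs)

  ∈-concatMap⁻′ : ∀ {A B : Set} (f : A → List B) xs {y} → y ∈ concatMap f xs → Σ A λ x → x ∈ xs × y ∈ f x
  ∈-concatMap⁻′ f xs y∈ = find (∈-concatMap⁻ f {xs = xs} y∈)

  Unique-concatMap : ∀ {A B : Set} (f : A → List B) (parent : B → A) xs → Unique xs →
    (∀ x → x ∈ xs → Unique (f x)) → (∀ x → x ∈ xs → ∀ y → y ∈ f x → parent y ≡ x) →
    Unique (concatMap f xs)
  Unique-concatMap f parent []       _          _        _      = []
  Unique-concatMap f parent (x ∷ xs) (x∉ ∷ uxs) unique-f parent≡ = Unique.++⁺ (unique-f x (here refl))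
    (Unique-concatMap f parent xs uxs (λ x′ → unique-f x′ ∘ there) (λ x′ → parent≡ x′ ∘ there))
    λ (y∈fx , y∈rest) → let x′ , x′∈xs , y∈fx′ = ∈-concatMap⁻′ f xs y∈rest in
      All.lookup x∉ x′∈xs (trans (sym (parent≡ x (here refl) _ y∈fx)) (parent≡ x′ (there x′∈xs) _ y∈fx′))

  Unique-++-disjoint : ∀ {A : Set} (xs : List A) {ys x} → Unique (xs ++ ys) → x ∈ xs → x ∉ ys
  Unique-++-disjoint (a ∷ xs) (a∉ ∷ _) (here refl) x∈ys = All.lookup a∉ (∈-++⁺ʳ xs x∈ys) refl
  Unique-++-disjoint (a ∷ xs) (_ ∷ u)  (there x∈xs) = Unique-++-disjoint xs u x∈xs

  Unique-++⁻ʳ : ∀ {A : Set} (xs : List A) {ys} → Unique (xs ++ ys) → Unique ys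
  Unique-++⁻ʳ []       u       = u
  Unique-++⁻ʳ (a ∷ xs) (_ ∷ u) = Unique-++⁻ʳ xs u

  -- A shape is the list of its row lengths, read through row, which pads it with zeros;
  -- lists that differ only by trailing zeros (_≈_ below) describe the same shape.

  row : List ℕ → ℕ → ℕ
  row []       _       = 0
  row (x ∷ s)  zero    = x
  row (x ∷ s)  (suc i) = row s i

  addCell : ℕ → List ℕ → List ℕ
  addCell zero    []      = 1 ∷ []
  addCell zero    (x ∷ s) = suc x ∷ s
  addCell (suc i) []      = 0 ∷ addCell i []
  addCell (suc i) (x ∷ s) = x ∷ addCell i s

  removeCell : ℕ → List ℕ → List ℕ
  removeCell _       []                  = []
  removeCell zero    (zero ∷ s)          = zero ∷ s
  removeCell zero    (suc zero ∷ [])     = []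
  removeCell zero    (suc zero ∷ y ∷ s)  = zero ∷ y ∷ s
  removeCell zero    (suc (suc x) ∷ s)   = suc x ∷ s
  removeCell (suc j) (x ∷ s)             = x ∷ removeCell j s

  -- Addable s (suc j) and Removable s j are the same condition: this is why a shape has
  -- exactly one more addable than removable cell.
  Addable : List ℕ → ℕ → Set
  Addable s zero    = ⊤
  Addable s (suc i) = row s (suc i) < row s i

  Removable : List ℕ → ℕ → Set
  Removable s j = row s (suc j) < row s j

  addable? : ∀ s → Decidable (Addable s)
  addable? s zero    = yes tt
  addable? s (suc i) = row s (suc i) <? row s i

  removable? : ∀ s → Decidable (Removable s)
  removable? s j = row s (suc j) <? row s j

  Decreasing : List ℕ → Set
  Decreasing s = ∀ i → row s (suc i) ≤ row s i

  IsPartition : List ℕ → Set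
  IsPartition s = Decreasing s × All (0 <_) s

  infix 4 _≈_
  _≈_ : List ℕ → List ℕ → Set
  s ≈ t = ∀ i → row s i ≡ row t i

  row-beyond : ∀ s {i} → length s ≤ i → row s i ≡ 0
  row-beyond []      _         = refl
  row-beyond (x ∷ s) (s≤s l≤i) = row-beyond s l≤i

  row-addCell-same : ∀ i s → row (addCell i s) i ≡ suc (row s i)
  row-addCell-same zero    []      = refl
  row-addCell-same zero    (x ∷ s) = refl
  row-addCell-same (suc i) []      = row-addCell-same i []
  row-addCell-same (suc i) (x ∷ s) = row-addCell-same i s

  row-addCell-other : ∀ i s {x} → x ≢ i → row (addCell i s) x ≡ row s x
  row-addCell-other zero    []      {zero}  x≢i = ⊥-elim (x≢i refl)
  row-addCell-other zero    []      {suc x} x≢i = refl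
  row-addCell-other zero    (y ∷ s) {zero}  x≢i = ⊥-elim (x≢i refl)
  row-addCell-other zero    (y ∷ s) {suc x} x≢i = refl
  row-addCell-other (suc i) []      {zero}  x≢i = refl
  row-addCell-other (suc i) []      {suc x} x≢i = row-addCell-other i [] (x≢i ∘ cong suc)
  row-addCell-other (suc i) (y ∷ s) {zero}  x≢i = refl
  row-addCell-other (suc i) (y ∷ s) {suc x} x≢i = row-addCell-other i s (x≢i ∘ cong suc)

  row-removeCell-same : ∀ j s → row (removeCell j s) j ≡ pred (row s j)
  row-removeCell-same j       []                 = refl
  row-removeCell-same zero    (zero ∷ s)         = refl
  row-removeCell-same zero    (suc zero ∷ [])    = refl
  row-removeCell-same zero    (suc zero ∷ y ∷ s) = refl
  row-removeCell-same zero    (suc (suc x) ∷ s)  = refl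
  row-removeCell-same (suc j) (x ∷ s)            = row-removeCell-same j s

  row-removeCell-other : ∀ j s {x} → x ≢ j → row (removeCell j s) x ≡ row s x
  row-removeCell-other j       []                 x≢j = refl
  row-removeCell-other zero    (zero ∷ s)         x≢j = refl
  row-removeCell-other zero    (suc zero ∷ [])    {zero}  x≢j = ⊥-elim (x≢j refl)
  row-removeCell-other zero    (suc zero ∷ [])    {suc x} x≢j = refl
  row-removeCell-other zero    (suc zero ∷ y ∷ s) {zero}  x≢j = ⊥-elim (x≢j refl)
  row-removeCell-other zero    (suc zero ∷ y ∷ s) {suc x} x≢j = refl
  row-removeCell-other zero    (suc (suc z) ∷ s)  {zero}  x≢j = ⊥-elim (x≢j refl)
  row-removeCell-other zero    (suc (suc z) ∷ s)  {suc x} x≢j = refl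
  row-removeCell-other (suc j) (y ∷ s)            {zero}  x≢j = refl
  row-removeCell-other (suc j) (y ∷ s)            {suc x} x≢j = row-removeCell-other j s (x≢j ∘ cong suc)

  Addable⇒≤length : ∀ s i → Addable s i → i ≤ length s
  Addable⇒≤length s zero    _ = z≤n
  Addable⇒≤length s (suc i) a with suc i ≤? length s
  ... | yes i<l = i<l
  ... | no  i≮l = ⊥-elim (<-irrefl refl (subst₂ _<_ (row-beyond s (m≤n⇒m≤1+n l≤i)) (row-beyond s l≤i) a))
    where l≤i = ≤-pred (≰⇒> i≮l)

  Removable⇒<length : ∀ s j → Removable s j → j < length s
  Removable⇒<length s j = Addable⇒≤length s (suc j)

  private
    pred-<-pred : ∀ {a b} → suc a < b → a < pred b
    pred-<-pred {b = suc b} (s≤s a<b) = a<b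

    <-pred⇒suc< : ∀ {a b} → a < pred b → suc a < b
    <-pred⇒suc< {b = suc b} a<b = s≤s a<b

    suc≢ : ∀ i → suc i ≢ i
    suc≢ i e = <-irrefl (sym e) (n<1+n i)

  addRemove⇒removeAdd : ∀ s i j → i ≢ j → Addable s i → Removable (addCell i s) j →
    Removable s j × Addable (removeCell j s) i
  addRemove⇒removeAdd s zero j i≢j a r =
    subst₂ _<_ (row-addCell-other 0 s λ ()) (row-addCell-other 0 s (i≢j ∘ sym)) r , tt
  addRemove⇒removeAdd s (suc i) j i≢j a r with suc j ≟ suc i
  ... | yes refl =
    let r′ : suc (row s (suc j)) < row s j
        r′ = subst₂ _<_ (row-addCell-same (suc j) s) (row-addCell-other (suc j) s (i≢j ∘ sym)) r
    in <-trans (n<1+n _) r′ ,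
       subst₂ _<_ (sym (row-removeCell-other j s (suc≢ j))) (sym (row-removeCell-same j s)) (pred-<-pred r′)
  ... | no j≢i =
    subst₂ _<_ (row-addCell-other (suc i) s j≢i) (row-addCell-other (suc i) s (i≢j ∘ sym)) r ,
    subst₂ _<_ (sym (row-removeCell-other j s i≢j)) (sym (row-removeCell-other j s (j≢i ∘ cong suc ∘ sym))) a

  removeAdd⇒addRemove : ∀ s i j → i ≢ j → Removable s j → Addable (removeCell j s) i →
    Addable s i × Removable (addCell i s) j
  removeAdd⇒addRemove s zero j i≢j r a =
    tt , subst₂ _<_ (sym (row-addCell-other 0 s λ ())) (sym (row-addCell-other 0 s (i≢j ∘ sym))) r
  removeAdd⇒addRemove s (suc i) j i≢j r a with i ≟ j
  ... | yes refl =
    let a′ : row s (suc i) < pred (row s i)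
        a′ = subst₂ _<_ (row-removeCell-other i s i≢j) (row-removeCell-same i s) a
    in r , subst₂ _<_ (sym (row-addCell-same (suc i) s)) (sym (row-addCell-other (suc i) s (i≢j ∘ sym)))
                      (<-pred⇒suc< a′)
  ... | no i≢j′ =
    subst₂ _<_ (row-removeCell-other j s i≢j) (row-removeCell-other j s i≢j′) a ,
    subst₂ _<_ (sym (row-addCell-other (suc i) s (i≢j′ ∘ sym ∘ suc-injective)))
               (sym (row-addCell-other (suc i) s (i≢j ∘ sym))) r

  addCell-removeCell-comm : ∀ s i j → i ≢ j → removeCell j (addCell i s) ≈ addCell i (removeCell j s)
  addCell-removeCell-comm s i j i≢j x with x ≟ i | x ≟ j
  ... | yes refl | _ = begin
    row (removeCell j (addCell x s)) x ≡⟨ row-removeCell-other j (addCell x s) i≢j ⟩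
    row (addCell x s) x                ≡⟨ row-addCell-same x s ⟩
    suc (row s x)                      ≡⟨ cong suc (sym (row-removeCell-other j s i≢j)) ⟩
    suc (row (removeCell j s) x)       ≡⟨ sym (row-addCell-same x (removeCell j s)) ⟩
    row (addCell x (removeCell j s)) x ∎
    where open ≡-Reasoning
  ... | no x≢i | yes refl = begin
    row (removeCell x (addCell i s)) x ≡⟨ row-removeCell-same x (addCell i s) ⟩
    pred (row (addCell i s) x)         ≡⟨ cong pred (row-addCell-other i s x≢i) ⟩
    pred (row s x)                     ≡⟨ sym (row-removeCell-same x s) ⟩
    row (removeCell x s) x             ≡⟨ sym (row-addCell-other i (removeCell x s) x≢i) ⟩
    row (addCell i (removeCell x s)) x ∎
    where open ≡-Reasoning
  ... | no x≢i | no x≢j = begin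
    row (removeCell j (addCell i s)) x ≡⟨ row-removeCell-other j (addCell i s) x≢j ⟩
    row (addCell i s) x                ≡⟨ row-addCell-other i s x≢i ⟩
    row s x                            ≡⟨ sym (row-removeCell-other j s x≢j) ⟩
    row (removeCell j s) x             ≡⟨ sym (row-addCell-other i (removeCell j s) x≢i) ⟩
    row (addCell i (removeCell j s)) x ∎
    where open ≡-Reasoning

  Removable-addCell : ∀ s i → Decreasing s → Removable (addCell i s) i
  Removable-addCell s i dec =
    subst₂ _<_ (sym (row-addCell-other i s (suc≢ i))) (sym (row-addCell-same i s)) (s≤s (dec i))

  removeCell-addCell : ∀ s i → removeCell i (addCell i s) ≈ s
  removeCell-addCell s i x with x ≟ i
  ... | yes refl = trans (row-removeCell-same x (addCell x s)) (cong pred (row-addCell-same x s))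
  ... | no x≢i = trans (row-removeCell-other i (addCell i s) x≢i) (row-addCell-other i s x≢i)

  Addable-removeCell : ∀ s j → Decreasing s → Removable s j → Addable (removeCell j s) j
  Addable-removeCell s zero    dec r = tt
  Addable-removeCell s (suc j) dec r with row s (suc j) | row-removeCell-same (suc j) s | dec j | r
  ... | suc v | row≡v | v<row | _ =
    subst₂ _<_ (sym row≡v) (sym (row-removeCell-other (suc j) s (suc≢ j ∘ sym))) v<row

  addCell-removeCell : ∀ s j → Removable s j → addCell j (removeCell j s) ≡ s
  addCell-removeCell (suc zero ∷ [])     zero    r = refl
  addCell-removeCell (suc zero ∷ y ∷ s)  zero    r = refl
  addCell-removeCell (suc (suc x) ∷ s)   zero    r = refl
  addCell-removeCell (x ∷ s)             (suc j) r = cong (x ∷_) (addCell-removeCell s j r)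

  removeCell-addCell-exact : ∀ s i → All (0 <_) s → i ≤ length s → removeCell i (addCell i s) ≡ s
  removeCell-addCell-exact []          zero    _        _ = refl
  removeCell-addCell-exact (suc x ∷ s) zero    _        _ = refl
  removeCell-addCell-exact (x ∷ s)     (suc i) (_ ∷ ps) (s≤s i≤l) = cong (x ∷_) (removeCell-addCell-exact s i ps i≤l)

  Decreasing-addCell : ∀ s i → Decreasing s → Addable s i → Decreasing (addCell i s)
  Decreasing-addCell s i dec a x with x ≟ i
  ... | yes refl =
    subst₂ _≤_ (sym (row-addCell-other x s (suc≢ x))) (sym (row-addCell-same x s)) (m≤n⇒m≤1+n (dec x))
  ... | no x≢i with suc x ≟ i
  ...   | yes refl = subst₂ _≤_ (sym (row-addCell-same (suc x) s)) (sym (row-addCell-other (suc x) s x≢i)) a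
  ...   | no sx≢i = subst₂ _≤_ (sym (row-addCell-other i s sx≢i)) (sym (row-addCell-other i s x≢i)) (dec x)

  Decreasing-removeCell : ∀ s j → Decreasing s → Removable s j → Decreasing (removeCell j s)
  Decreasing-removeCell s j dec r x with x ≟ j
  ... | yes refl =
    subst₂ _≤_ (sym (row-removeCell-other x s (suc≢ x))) (sym (row-removeCell-same x s)) (pred-mono-≤ r)
  ... | no x≢j with suc x ≟ j
  ...   | yes refl = subst₂ _≤_ (sym (row-removeCell-same (suc x) s)) (sym (row-removeCell-other (suc x) s x≢j))
                                 (≤-trans pred[n]≤n (dec x))
  ...   | no sx≢j = subst₂ _≤_ (sym (row-removeCell-other j s sx≢j)) (sym (row-removeCell-other j s x≢j)) (dec x)

  Positive-addCell : ∀ s i → All (0 <_) s → i ≤ length s → All (0 <_) (addCell i s)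
  Positive-addCell []      zero    _        _         = z<s ∷ []
  Positive-addCell (x ∷ s) zero    (_ ∷ ps) _         = z<s ∷ ps
  Positive-addCell (x ∷ s) (suc i) (p ∷ ps) (s≤s i≤l) = p ∷ Positive-addCell s i ps i≤l

  IsPartition-addCell : ∀ s i → IsPartition s → Addable s i → IsPartition (addCell i s)
  IsPartition-addCell s i (dec , pos) a =
    Decreasing-addCell s i dec a , Positive-addCell s i pos (Addable⇒≤length s i a)

  addCell-≈ : ∀ i {s t} → s ≈ t → addCell i s ≈ addCell i t
  addCell-≈ i {s} {t} s≈t x with x ≟ i
  ... | yes refl = trans (row-addCell-same i s) (trans (cong suc (s≈t i)) (sym (row-addCell-same i t)))
  ... | no x≢i = trans (row-addCell-other i s x≢i) (trans (s≈t x) (sym (row-addCell-other i t x≢i)))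

  Addable-≈ : ∀ {s t} → s ≈ t → ∀ i → Addable s i → Addable t i
  Addable-≈ s≈t zero    a = tt
  Addable-≈ s≈t (suc i) a = subst₂ _<_ (s≈t (suc i)) (s≈t i) a

  length-addCell : ∀ i s → i ≤ length s → length (addCell i s) ≤ suc (length s)
  length-addCell zero    []      _         = ≤-refl
  length-addCell zero    (x ∷ s) _         = n≤1+n _
  length-addCell (suc i) (x ∷ s) (s≤s i≤l) = s≤s (length-addCell i s i≤l)

  length-removeCell : ∀ j s → length (removeCell j s) ≤ length s
  length-removeCell j       []                 = z≤n
  length-removeCell zero    (zero ∷ s)         = ≤-refl
  length-removeCell zero    (suc zero ∷ [])    = z≤n
  length-removeCell zero    (suc zero ∷ y ∷ s) = ≤-refl
  length-removeCell zero    (suc (suc x) ∷ s)  = ≤-refl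
  length-removeCell (suc j) (x ∷ s)            = s≤s (length-removeCell j s)

  upTerm : (List ℕ → ℕ) → List ℕ → ℕ → ℕ
  upTerm f s i = when (addable? s i) (f (addCell i s))

  downTerm : (List ℕ → ℕ) → List ℕ → ℕ → ℕ
  downTerm f s j = when (removable? s j) (f (removeCell j s))

  up : (List ℕ → ℕ) → List ℕ → ℕ
  up f s = sumBelow (suc (length s)) (upTerm f s)

  down : (List ℕ → ℕ) → List ℕ → ℕ
  down f s = sumBelow (length s) (downTerm f s)

  up-extend : ∀ f s {B} → suc (length s) ≤ B → up f s ≡ sumBelow B (upTerm f s)
  up-extend f s l<B = ∑-extend (upTerm f s) l<B λ i l<i →
    when-fails (addable? s i) (λ a → ≤⇒≯ (Addable⇒≤length s i a) l<i) _

  down-extend : ∀ f s {B} → length s ≤ B → down f s ≡ sumBelow B (downTerm f s)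
  down-extend f s l≤B = ∑-extend (downTerm f s) l≤B λ j l≤j →
    when-fails (removable? s j) (λ r → ≤⇒≯ l≤j (Removable⇒<length s j r)) _

  up-cong : ∀ f g s → (∀ i → Addable s i → f (addCell i s) ≡ g (addCell i s)) → up f s ≡ up g s
  up-cong f g s f≡g = ∑-cong (suc (length s)) λ i _ → when-cong (addable? s i) (f≡g i)

  up-+ : ∀ f g s → up (λ τ → f τ + g τ) s ≡ up f s + up g s
  up-+ f g s = trans (∑-cong (suc (length s)) λ i _ → when-+ (addable? s i) (f (addCell i s)) (g (addCell i s)))
                     (∑-+ (suc (length s)) (upTerm f s) (upTerm g s))

  up-* : ∀ c f s → up (λ τ → c * f τ) s ≡ c * up f s
  up-* c f s = trans (∑-cong (suc (length s)) λ i _ → sym (*-when (addable? s i) c (f (addCell i s))))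
                     (∑-* (suc (length s)) c (upTerm f s))

  up-const : ∀ c s → up (λ _ → c) s ≡ c * up (λ _ → 1) s
  up-const c s = trans (up-cong (λ _ → c) (λ _ → c * 1) s λ _ _ → sym (*-identityʳ c)) (up-* c (λ _ → 1) s)

  down-const : ∀ c s → down (λ _ → c) s ≡ c * down (λ _ → 1) s
  down-const c s = trans
    (∑-cong (length s) λ j _ → sym (trans (*-when (removable? s j) c 1) (cong (when (removable? s j)) (*-identityʳ c))))
    (∑-* (length s) c (downTerm (λ _ → 1) s))

  Respects≈ : (List ℕ → ℕ) → Set
  Respects≈ f = ∀ s t → s ≈ t → f s ≡ f t

  up-≈ : ∀ {f} → Respects≈ f → Respects≈ (up f)
  up-≈ {f} f-≈ s t s≈t = begin
    up f s                  ≡⟨ up-extend f s (s≤s (m≤m+n (length s) (length t))) ⟩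
    sumBelow B (upTerm f s) ≡⟨ ∑-cong B (λ i _ → termwise i) ⟩
    sumBelow B (upTerm f t) ≡⟨ up-extend f t (s≤s (m≤n+m (length t) (length s))) ⟨
    up f t                  ∎
    where
    open ≡-Reasoning
    B = suc (length s + length t)
    termwise : ∀ i → upTerm f s i ≡ upTerm f t i
    termwise i = when-when (addable? s i) (yes tt) (addable? t i) (yes tt)
      (λ a _ → Addable-≈ s≈t i a , tt) (λ a _ → Addable-≈ (sym ∘ s≈t) i a , tt)
      (λ _ _ _ _ → f-≈ (addCell i s) (addCell i t) (addCell-≈ i s≈t))

  -- Young's lattice is 1-differential (D U = U D + I).  Both sides are double sums over a
  -- cell i to add and a cell j to remove; the terms with i ≢ j agree, and on the diagonal
  -- the left side has one term per addable and the right one per removable cell.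
  module UpDown {f : List ℕ → ℕ} (f-≈ : Respects≈ f) (s : List ℕ) (dec : Decreasing s) where

    private
      B = suc (suc (length s))

      addRemove : ℕ → ℕ → ℕ
      addRemove i j = when (addable? s i) (downTerm f (addCell i s) j)

      removeAdd : ℕ → ℕ → ℕ
      removeAdd j i = when (removable? s j) (upTerm f (removeCell j s) i)

      up-down-double : up (down f) s ≡ ∑[ i < B ] ∑[ j < B ] addRemove i j
      up-down-double = trans (up-extend (down f) s (n≤1+n _)) (∑-cong B λ i _ →
        trans (when-cong (addable? s i) λ a →
                 down-extend f (addCell i s) (≤-trans (length-addCell i s (Addable⇒≤length s i a)) (n≤1+n _)))
              (when-∑ (addable? s i) B (downTerm f (addCell i s))))

      down-up-double : down (up f) s ≡ ∑[ i < B ] ∑[ j < B ] removeAdd j i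
      down-up-double = trans (down-extend (up f) s (≤-trans (n≤1+n _) (n≤1+n _))) (trans (∑-cong B λ j _ →
        trans (when-cong (removable? s j) λ _ →
                 up-extend f (removeCell j s) (s≤s (≤-trans (length-removeCell j s) (n≤1+n _))))
              (when-∑ (removable? s j) B (upTerm f (removeCell j s))))
        (∑-swap B B removeAdd))

      off-diagonal : ∀ i j → i ≢ j → addRemove i j ≡ removeAdd j i
      off-diagonal i j i≢j =
        when-when (addable? s i) (removable? (addCell i s) j) (removable? s j) (addable? (removeCell j s) i)
          (addRemove⇒removeAdd s i j i≢j) (removeAdd⇒addRemove s i j i≢j)
          λ _ _ _ _ → f-≈ (removeCell j (addCell i s)) (addCell i (removeCell j s)) (addCell-removeCell-comm s i j i≢j)

      swap-off-diagonal : ∀ i j →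
        addRemove i j + when (i ≟ j) (removeAdd j i) ≡ removeAdd j i + when (i ≟ j) (addRemove i j)
      swap-off-diagonal i j with i ≟ j
      ... | yes refl = begin
        addRemove i i + when (i ≟ i) (removeAdd i i) ≡⟨ cong (addRemove i i +_) (when-holds (i ≟ i) refl _) ⟩
        addRemove i i + removeAdd i i                ≡⟨ +-comm (addRemove i i) (removeAdd i i) ⟩
        removeAdd i i + addRemove i i                ≡⟨ cong (removeAdd i i +_) (when-holds (i ≟ i) refl _) ⟨
        removeAdd i i + when (i ≟ i) (addRemove i i) ∎
        where open ≡-Reasoning
      ... | no i≢j =
        cong₂ _+_ (off-diagonal i j i≢j) (trans (when-fails (i ≟ j) i≢j _) (sym (when-fails (i ≟ j) i≢j _)))

      diagonal-addRemove : ∑[ i < B ] addRemove i i ≡ f s * up (λ _ → 1) s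
      diagonal-addRemove = trans (∑-cong B λ i _ → when-cong (addable? s i) λ _ →
          trans (when-holds (removable? (addCell i s) i) (Removable-addCell s i dec) _)
                (f-≈ (removeCell i (addCell i s)) s (removeCell-addCell s i)))
        (trans (sym (up-extend (λ _ → f s) s (n≤1+n _))) (up-const (f s) s))

      diagonal-removeAdd : ∑[ i < B ] removeAdd i i ≡ f s * down (λ _ → 1) s
      diagonal-removeAdd = trans (∑-cong B λ j _ → when-cong (removable? s j) λ r →
          trans (when-holds (addable? (removeCell j s) j) (Addable-removeCell s j dec r) _)
                (cong f (addCell-removeCell s j r)))
        (trans (sym (down-extend (λ _ → f s) s (≤-trans (n≤1+n _) (n≤1+n _)))) (down-const (f s) s))

      ∑∑-+-diagonal : ∀ (g h : ℕ → ℕ → ℕ) →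
        ∑[ i < B ] ∑[ j < B ] (g i j + when (i ≟ j) (h i j)) ≡ ∑[ i < B ] ∑[ j < B ] g i j + ∑[ i < B ] h i i
      ∑∑-+-diagonal g h = trans
        (∑-cong B λ i i<B → trans (∑-+ B (g i) (λ j → when (i ≟ j) (h i j)))
                                   (cong (sumBelow B (g i) +_) (∑-delta B i (h i) i<B)))
        (∑-+ B (λ i → sumBelow B (g i)) (λ i → h i i))

      commute-with-diagonals : up (down f) s + f s * down (λ _ → 1) s ≡ down (up f) s + f s * up (λ _ → 1) s
      commute-with-diagonals = begin
        up (down f) s + f s * down (λ _ → 1) s
          ≡⟨ cong₂ _+_ up-down-double (sym diagonal-removeAdd) ⟩
        ∑[ i < B ] ∑[ j < B ] addRemove i j + ∑[ i < B ] removeAdd i i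
          ≡⟨ ∑∑-+-diagonal addRemove (λ i j → removeAdd j i) ⟨
        ∑[ i < B ] ∑[ j < B ] (addRemove i j + when (i ≟ j) (removeAdd j i))
          ≡⟨ ∑-cong B (λ i _ → ∑-cong B λ j _ → swap-off-diagonal i j) ⟩
        ∑[ i < B ] ∑[ j < B ] (removeAdd j i + when (i ≟ j) (addRemove i j))
          ≡⟨ ∑∑-+-diagonal (λ i j → removeAdd j i) addRemove ⟩
        ∑[ i < B ] ∑[ j < B ] removeAdd j i + ∑[ i < B ] addRemove i i
          ≡⟨ cong₂ _+_ (sym down-up-double) diagonal-addRemove ⟩
        down (up f) s + f s * up (λ _ → 1) s ∎
        where open ≡-Reasoning

    -- up (λ _ → 1) s ≡ suc (down (λ _ → 1) s) holds by definition (see Addable).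
    up-down-commute : up (down f) s ≡ f s + down (up f) s
    up-down-commute = +-cancelʳ-≡ (f s * down (λ _ → 1) s) _ _
      (trans commute-with-diagonals (rearrange (down (up f) s) (f s) (down (λ _ → 1) s)))
      where
      rearrange : ∀ x y r → x + y * suc r ≡ y + x + y * r
      rearrange = solve-∀

  open UpDown using (up-down-commute)

  -- pathSum g m s sums g over the ends of all paths s ⋖ s₁ ⋖ ⋯ ⋖ sₘ in Young's lattice,
  -- i.e. over the standard fillings of skew shapes λ/s with m cells, weighted by g λ.
  pathSum : (List ℕ → ℕ) → ℕ → List ℕ → ℕ
  pathSum g zero    s = g s
  pathSum g (suc m) s = up (pathSum g m) s

  paths : ℕ → List ℕ → ℕ
  paths = pathSum (λ _ → 1)

  paths-≈ : ∀ m → Respects≈ (paths m)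
  paths-≈ zero    _ _ _   = refl
  paths-≈ (suc m) = up-≈ (paths-≈ m)

  paths-positive : ∀ m s → 0 < paths m s
  paths-positive zero    s = z<s
  paths-positive (suc m) s = ≤-trans (paths-positive m (addCell 0 s)) (m≤m+n _ _)

  paths-recurrence : ∀ m s → Decreasing s →
    paths (suc m) s ≡ paths m s + m * paths (pred m) s + down (paths m) s
  paths-recurrence zero    s dec = refl
  paths-recurrence (suc m) s dec = begin
    up (paths (suc m)) s
      ≡⟨ up-cong (paths (suc m)) (λ τ → paths m τ + m * paths (pred m) τ + down (paths m) τ) s
                 (λ i a → paths-recurrence m (addCell i s) (Decreasing-addCell s i dec a)) ⟩
    up (λ τ → paths m τ + m * paths (pred m) τ + down (paths m) τ) s
      ≡⟨ trans (up-+ (λ τ → paths m τ + m * paths (pred m) τ) (down (paths m)) s)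
               (cong (_+ up (down (paths m)) s) (trans (up-+ (paths m) (λ τ → m * paths (pred m) τ) s)
                                                        (cong (paths (suc m) s +_) (up-* m (paths (pred m)) s)))) ⟩
    paths (suc m) s + m * paths (suc (pred m)) s + up (down (paths m)) s
      ≡⟨ cong₂ (λ x y → paths (suc m) s + x + y) (m*paths-suc-pred m) (up-down-commute (paths-≈ m) s dec) ⟩
    paths (suc m) s + m * paths m s + (paths m s + down (paths (suc m)) s)
      ≡⟨ rearrange (paths (suc m) s) m (paths m s) _ ⟩
    paths (suc m) s + suc m * paths m s + down (paths (suc m)) s ∎
    where
    open ≡-Reasoning
    m*paths-suc-pred : ∀ m → m * paths (suc (pred m)) s ≡ m * paths m s
    m*paths-suc-pred zero    = refl
    m*paths-suc-pred (suc m) = refl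
    rearrange : ∀ x n y q → x + n * y + (y + q) ≡ x + suc n * y + q
    rearrange = solve-∀

  pathSum-shift : ∀ g m s → pathSum g (suc m) s ≡ pathSum (up g) m s
  pathSum-shift g zero    s = refl
  pathSum-shift g (suc m) s =
    up-cong (pathSum g (suc m)) (pathSum (up g) m) s λ i _ → pathSum-shift g m (addCell i s)

  pathSum-cong : ∀ {g h} m {s} → IsPartition s → (∀ τ → IsPartition τ → g τ ≡ h τ) →
    pathSum g m s ≡ pathSum h m s
  pathSum-cong zero    part g≡h = g≡h _ part
  pathSum-cong {g} {h} (suc m) {s} part g≡h =
    up-cong (pathSum g m) (pathSum h m) s λ i a → pathSum-cong m (IsPartition-addCell s i part a) g≡h

  pathSum-+ : ∀ g h m s → pathSum (λ τ → g τ + h τ) m s ≡ pathSum g m s + pathSum h m s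
  pathSum-+ g h zero    s = refl
  pathSum-+ g h (suc m) s = trans
    (up-cong (pathSum (λ τ → g τ + h τ) m) (λ τ → pathSum g m τ + pathSum h m τ) s λ i _ →
       pathSum-+ g h m (addCell i s))
    (up-+ (pathSum g m) (pathSum h m) s)

  pathSum-* : ∀ c g m s → pathSum (λ τ → c * g τ) m s ≡ c * pathSum g m s
  pathSum-* c g zero    s = refl
  pathSum-* c g (suc m) s = trans
    (up-cong (pathSum (λ τ → c * g τ) m) (λ τ → c * pathSum g m τ) s λ i _ → pathSum-* c g m (addCell i s))
    (up-* c (pathSum g m) s)

  pathSum-when : ∀ {Q : Set} (d : Dec Q) g m s → pathSum (λ τ → when d (g τ)) m s ≡ when d (pathSum g m s)
  pathSum-when (yes _) g m s = refl
  pathSum-when (no _)  g m s = pathSum-* 0 g m s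

  pathSum-∑-when : ∀ n {Q : ℕ → Set} (Q? : ∀ j → Dec (Q j)) (g : ℕ → List ℕ → ℕ) m s →
    pathSum (λ τ → ∑[ j < n ] when (Q? j) (g j τ)) m s ≡ ∑[ j < n ] when (Q? j) (pathSum (g j) m s)
  pathSum-∑-when zero    Q? g m s = pathSum-* 0 (λ _ → 0) m s
  pathSum-∑-when (suc n) Q? g m s = trans
    (pathSum-+ (λ τ → when (Q? 0) (g 0 τ)) (λ τ → ∑[ j < n ] when (Q? (suc j)) (g (suc j) τ)) m s)
    (cong₂ _+_ (pathSum-when (Q? 0) (g 0) m s) (pathSum-∑-when n (Q? ∘ suc) (g ∘ suc) m s))

  _≟ₛ_ : DecidableEquality (List ℕ)
  _≟ₛ_ = ≡-dec _≟_

  atShape : List ℕ → List ℕ → ℕ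
  atShape μ τ = when (τ ≟ₛ μ) 1

  shapeCount : ℕ → List ℕ → ℕ
  shapeCount k μ = pathSum (atShape μ) k []

  up-atShape : ∀ τ μ → IsPartition τ → Decreasing μ → up (atShape μ) τ ≡ down (λ ν → atShape ν τ) μ
  up-atShape τ μ (decτ , posτ) decμ = begin
    up (atShape μ) τ
      ≡⟨ up-extend (atShape μ) τ (m≤m+n _ (length μ)) ⟩
    sumBelow B (upTerm (atShape μ) τ)
      ≡⟨ ∑-cong B (λ i _ → termwise i) ⟩
    sumBelow B (downTerm (λ ν → atShape ν τ) μ)
      ≡⟨ sym (down-extend (λ ν → atShape ν τ) μ (≤-trans (m≤n+m (length μ) (length τ)) (n≤1+n _))) ⟩
    down (λ ν → atShape ν τ) μ ∎
    where
    open ≡-Reasoning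
    B = suc (length τ) + length μ
    termwise : ∀ i → upTerm (atShape μ) τ i ≡ downTerm (λ ν → atShape ν τ) μ i
    termwise i = when-when (addable? τ i) (addCell i τ ≟ₛ μ) (removable? μ i) (τ ≟ₛ removeCell i μ)
      (λ { a refl → Removable-addCell τ i decτ ,
                    sym (removeCell-addCell-exact τ i posτ (Addable⇒≤length τ i a)) })
      (λ { r refl → Addable-removeCell μ i decμ r , addCell-removeCell μ i r })
      (λ _ _ _ _ → refl)

  []-IsPartition : IsPartition []
  []-IsPartition = (λ _ → z≤n) , []

  shapeCount-recurrence : ∀ k μ → Decreasing μ → shapeCount (suc k) μ ≡ down (shapeCount k) μ
  shapeCount-recurrence k μ decμ = begin
    pathSum (atShape μ) (suc k) []
      ≡⟨ pathSum-shift (atShape μ) k [] ⟩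
    pathSum (up (atShape μ)) k []
      ≡⟨ pathSum-cong k []-IsPartition (λ τ part → up-atShape τ μ part decμ) ⟩
    pathSum (λ τ → down (λ ν → atShape ν τ) μ) k []
      ≡⟨ pathSum-∑-when (length μ) (removable? μ) (λ j → atShape (removeCell j μ)) k [] ⟩
    down (shapeCount k) μ ∎
    where open ≡-Reasoning

  Eventually : (ℕ → Set) → Set
  Eventually P = Σ ℕ λ M → ∀ m → M ≤ m → P m

  eventually-× : ∀ {P Q : ℕ → Set} → Eventually P → Eventually Q → Eventually (λ m → P m × Q m)
  eventually-× (M , p) (N , q) =
    M ⊔ N , λ m M⊔N≤m → p m (≤-trans (m≤m⊔n M N) M⊔N≤m) , q m (≤-trans (m≤n⊔m M N) M⊔N≤m)

  -- x / y ≤ c / d + 1 / q, with the denominators cleared.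
  RatioBound : ℕ → ℕ → ℕ → ℕ → ℕ → Set
  RatioBound q x y c d = q * x * d ≤ (q * c + d) * y

  infix 4 _/_⟶_/_
  _/_⟶_/_ : (ℕ → ℕ) → (ℕ → ℕ) → ℕ → ℕ → Set
  a / u ⟶ c / d = ∀ q → Eventually λ m → RatioBound q (a m) (u m) c d × RatioBound q c d (a m) (u m)

  RatioBound-exact : ∀ q {x y c d} → x * d ≡ c * y → RatioBound q x y c d
  RatioBound-exact q {x} {y} {c} {d} xd≡cy = begin
    q * x * d       ≡⟨ *-assoc q x d ⟩
    q * (x * d)     ≡⟨ cong (q *_) xd≡cy ⟩
    q * (c * y)     ≡⟨ *-assoc q c y ⟨
    q * c * y       ≤⟨ *-monoˡ-≤ y (m≤m+n (q * c) d) ⟩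
    (q * c + d) * y ∎
    where open ≤-Reasoning

  RatioBound-+ : ∀ q {x x′ y c c′ d} → RatioBound (2 * q) x y c d → RatioBound (2 * q) x′ y c′ d →
    RatioBound q (x + x′) y (c + c′) d
  RatioBound-+ q {x} {x′} {y} {c} {c′} {d} b b′ = *-cancelˡ-≤ 2 (begin
    2 * (q * (x + x′) * d)                            ≡⟨ split q x x′ d ⟩
    2 * q * x * d + 2 * q * x′ * d                    ≤⟨ +-mono-≤ b b′ ⟩
    (2 * q * c + d) * y + (2 * q * c′ + d) * y        ≡⟨ merge q c c′ d y ⟩
    2 * ((q * (c + c′) + d) * y)                      ∎)
    where
    open ≤-Reasoning
    split : ∀ q x x′ d → 2 * (q * (x + x′) * d) ≡ 2 * q * x * d + 2 * q * x′ * d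
    split = solve-∀
    merge : ∀ q c c′ d y → (2 * q * c + d) * y + (2 * q * c′ + d) * y ≡ 2 * ((q * (c + c′) + d) * y)
    merge = solve-∀

  ⟶-exact : ∀ {a u c d} → (∀ m → a m * d ≡ c * u m) → a / u ⟶ c / d
  ⟶-exact ad≡cu q = 0 , λ m _ → RatioBound-exact q (ad≡cu m) , RatioBound-exact q (sym (ad≡cu m))

  ⟶-+ : ∀ {a b u c e d} → a / u ⟶ c / d → b / u ⟶ e / d → (λ m → a m + b m) / u ⟶ (c + e) / d
  ⟶-+ a⟶ b⟶ q with eventually-× (a⟶ (2 * q)) (b⟶ (2 * q))
  ... | M , bounds = M , λ m M≤m →
    let (a≤ , ≤a) , (b≤ , ≤b) = bounds m M≤m in RatioBound-+ q a≤ b≤ , RatioBound-+ q ≤a ≤b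

  ⟶-when : ∀ {a u c d} (D : Dec P) → (P → a / u ⟶ c / d) → (λ m → when D (a m)) / u ⟶ when D c / d
  ⟶-when (yes p) a⟶ = a⟶ p
  ⟶-when (no _)  a⟶ = ⟶-exact λ _ → refl

  ⟶-∑ : ∀ n {a : ℕ → ℕ → ℕ} {u c : ℕ → ℕ} {d} → (∀ j → j < n → a j / u ⟶ c j / d) →
    (λ m → ∑[ j < n ] a j m) / u ⟶ (∑[ j < n ] c j) / d
  ⟶-∑ zero    a⟶ = ⟶-exact λ _ → refl
  ⟶-∑ (suc n) {a} {c = c} a⟶ =
    ⟶-+ (a⟶ 0 z<s) (⟶-∑ n {a ∘ suc} {c = c ∘ suc} λ j j<n → a⟶ (suc j) (s<s j<n))

  ⟶-shift : ∀ {a u c d} → a / u ⟶ c / d → (a ∘ suc) / (u ∘ suc) ⟶ c / d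
  ⟶-shift a⟶ q with a⟶ q
  ... | M , bounds = M , λ m M≤m → bounds (suc m) (m≤n⇒m≤1+n M≤m)

  ⟶-cong : ∀ {a u u′ c d} → (∀ m → u m ≡ u′ m) → a / u ⟶ c / d → a / u′ ⟶ c / d
  ⟶-cong {a} {c = c} {d} u≡u′ a⟶ q with a⟶ q
  ... | M , bounds =
    M , λ m M≤m → subst (λ y → RatioBound q (a m) y c d × RatioBound q c d (a m) y) (u≡u′ m) (bounds m M≤m)

  -- For g = 0 this is the recurrence of the numbers of involutions, which count standard
  -- Young tableaux.
  record RecurrentWith (g x : ℕ → ℕ) : Set where
    constructor recurrent
    field
      recurrence : ∀ m → x (suc (suc m)) ≡ x (suc m) + suc m * x m + g m

  open RecurrentWith

  RecurrentWith-cong : ∀ {g g′ x} → (∀ m → g m ≡ g′ m) → RecurrentWith g x → RecurrentWith g′ x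
  RecurrentWith-cong g≡g′ x-rec = recurrent λ m → trans (recurrence x-rec m) (cong (_ +_) (g≡g′ m))

  RecurrentWith-+ : ∀ {g h x y} → RecurrentWith g x → RecurrentWith h y →
    RecurrentWith (λ m → g m + h m) (λ m → x m + y m)
  RecurrentWith-+ {g} {h} {x} {y} x-rec y-rec = recurrent λ m →
    trans (cong₂ _+_ (recurrence x-rec m) (recurrence y-rec m))
          (rearrange (x (suc m)) (suc m) (x m) (g m) (y (suc m)) (y m) (h m))
    where
    rearrange : ∀ x₁ n x₀ g y₁ y₀ h →
      x₁ + n * x₀ + g + (y₁ + n * y₀ + h) ≡ x₁ + y₁ + n * (x₀ + y₀) + (g + h)
    rearrange = solve-∀

  RecurrentWith-* : ∀ c {g x} → RecurrentWith g x → RecurrentWith (λ m → c * g m) (λ m → c * x m)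
  RecurrentWith-* c {g} {x} x-rec = recurrent λ m →
    trans (cong (c *_) (recurrence x-rec m)) (rearrange c (x (suc m)) (suc m) (x m) (g m))
    where
    rearrange : ∀ c x₁ n x₀ g → c * (x₁ + n * x₀ + g) ≡ c * x₁ + n * (c * x₀) + c * g
    rearrange = solve-∀

  comparison : ∀ {g h x y} M → RecurrentWith g x → RecurrentWith h y → (∀ m → M ≤ m → g m ≤ h m) →
    x M ≤ y M → x (suc M) ≤ y (suc M) → ∀ m → M ≤ m → x m ≤ y m
  comparison {g} {h} {x} {y} M x-rec y-rec g≤h x≤y x≤y′ m M≤m =
    subst (λ k → x k ≤ y k) (m∸n+n≡m M≤m) (proj₁ (consecutive (m ∸ M)))
    where
    open ≤-Reasoning
    consecutive : ∀ j → x (j + M) ≤ y (j + M) × x (suc (j + M)) ≤ y (suc (j + M))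
    consecutive zero    = x≤y , x≤y′
    consecutive (suc j) with consecutive j
    ... | x≤y₀ , x≤y₁ = x≤y₁ , (begin
      x (suc (suc (j + M)))                               ≡⟨ recurrence x-rec (j + M) ⟩
      x (suc (j + M)) + suc (j + M) * x (j + M) + g (j + M)
        ≤⟨ +-mono-≤ (+-mono-≤ x≤y₁ (*-monoʳ-≤ (suc (j + M)) x≤y₀)) (g≤h (j + M) (m≤n+m M j)) ⟩
      y (suc (j + M)) + suc (j + M) * y (j + M) + h (j + M) ≡⟨ recurrence y-rec (j + M) ⟨
      y (suc (suc (j + M)))                               ∎)

  -- A positive solution t of the homogeneous recurrence absorbs the initial values of x.
  dominated : ∀ {g h x y t} M → RecurrentWith g x → RecurrentWith h y → RecurrentWith (λ _ → 0) t →
    (∀ m → 1 ≤ t m) → (∀ m → M ≤ m → g m ≤ h m) → ∀ m → M ≤ m → x m ≤ y m + (x M + x (suc M)) * t m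
  dominated {g} {h} {x} {y} {t} M x-rec y-rec t-rec t-pos g≤h =
    comparison M x-rec z-rec g≤h (initial M (m≤m+n _ _)) (initial (suc M) (m≤n+m _ _))
    where
    K = x M + x (suc M)
    z-rec : RecurrentWith h (λ m → y m + K * t m)
    z-rec = RecurrentWith-cong (λ m → trans (cong (h m +_) (*-zeroʳ K)) (+-identityʳ (h m)))
                               (RecurrentWith-+ y-rec (RecurrentWith-* K t-rec))
    initial : ∀ m → x m ≤ K → x m ≤ y m + K * t m
    initial m x≤K = ≤-trans x≤K (≤-trans (subst (_≤ K * t m) (*-identityʳ K) (*-monoʳ-≤ K (t-pos m))) (m≤n+m _ _))

  -- Each one-sided bound compares two solutions of the recurrence (q·k·d·a with (q·C + d)·u,
  -- and q·C·u with q·k·d·a + d·u) whose forcing terms are eventually ordered by g⟶; the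
  -- initial values cost a multiple of t, which is o(u).
  module Sandwich {k d C : ℕ} {a g u t : ℕ → ℕ} (2≤k : 2 ≤ k) (1≤d : 1 ≤ d)
    (a-rec : RecurrentWith g a) (u-rec : RecurrentWith (λ m → k * u m) u) (t-rec : RecurrentWith (λ _ → 0) t)
    (t-pos : ∀ m → 1 ≤ t m) (t-small : ∀ m → suc m * t m ≤ u m) (g⟶ : g / u ⟶ C / d) where

    private
      open ≤-Reasoning

      absorb : ∀ K m → K ≤ m → K * t m ≤ u m
      absorb K m K≤m = ≤-trans (*-monoˡ-≤ (t m) (m≤n⇒m≤1+n K≤m)) (t-small m)

      1+d≤kd : suc d ≤ k * d
      1+d≤kd = begin
        suc d  ≤⟨ +-monoˡ-≤ d 1≤d ⟩
        d + d  ≡⟨ cong (d +_) (+-identityʳ d) ⟨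
        2 * d  ≤⟨ *-monoˡ-≤ d 2≤k ⟩
        k * d  ∎

      c : ℕ → ℕ
      c q = q * (k * d)

      upper : ∀ q → Eventually λ m → RatioBound q (a m) (u m) C (k * d)
      upper q with g⟶ q
      ... | M , g-bounds = M ⊔ K , bound
        where
        K = c q * a M + c q * a (suc M)
        x≤y : ∀ m → M ≤ m → c q * a m ≤ (q * C + d) * u m + K * t m
        x≤y = dominated M (RecurrentWith-* (c q) a-rec) (RecurrentWith-* (q * C + d) u-rec) t-rec t-pos λ m M≤m → begin
          c q * g m                 ≡⟨ regroup q k d (g m) ⟩
          k * (q * g m * d)         ≤⟨ *-monoʳ-≤ k (proj₁ (g-bounds m M≤m)) ⟩
          k * ((q * C + d) * u m)   ≡⟨ swap k (q * C + d) (u m) ⟩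
          (q * C + d) * (k * u m)   ∎
          where
          regroup : ∀ q k d g → q * (k * d) * g ≡ k * (q * g * d)
          regroup = solve-∀
          swap : ∀ k x u → k * (x * u) ≡ x * (k * u)
          swap = solve-∀
        bound : ∀ m → M ⊔ K ≤ m → RatioBound q (a m) (u m) C (k * d)
        bound m M⊔K≤m = begin
          q * a m * (k * d)               ≡⟨ regroup q (a m) (k * d) ⟩
          c q * a m                       ≤⟨ x≤y m (≤-trans (m≤m⊔n M K) M⊔K≤m) ⟩
          (q * C + d) * u m + K * t m     ≤⟨ +-monoʳ-≤ _ (absorb K m (≤-trans (m≤n⊔m M K) M⊔K≤m)) ⟩
          (q * C + d) * u m + u m         ≡⟨ collect (q * C) d (u m) ⟩
          (q * C + suc d) * u m           ≤⟨ *-monoˡ-≤ (u m) (+-monoʳ-≤ (q * C) 1+d≤kd) ⟩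
          (q * C + k * d) * u m           ∎
          where
          regroup : ∀ q a e → q * a * e ≡ q * e * a
          regroup = solve-∀
          collect : ∀ x d u → (x + d) * u + u ≡ (x + suc d) * u
          collect = solve-∀

      lower : ∀ q → Eventually λ m → RatioBound q C (k * d) (a m) (u m)
      lower q with g⟶ q
      ... | M , g-bounds = M ⊔ K , bound
        where
        K = q * C * u M + q * C * u (suc M)
        y-rec : RecurrentWith (λ m → c q * g m + d * (k * u m)) (λ m → c q * a m + d * u m)
        y-rec = RecurrentWith-+ (RecurrentWith-* (c q) a-rec) (RecurrentWith-* d u-rec)
        x≤y : ∀ m → M ≤ m → q * C * u m ≤ (c q * a m + d * u m) + K * t m
        x≤y = dominated M (RecurrentWith-* (q * C) u-rec) y-rec t-rec t-pos λ m M≤m → begin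
          q * C * (k * u m)             ≡⟨ regroup q C k (u m) ⟩
          k * (q * C * u m)             ≤⟨ *-monoʳ-≤ k (proj₂ (g-bounds m M≤m)) ⟩
          k * ((q * g m + u m) * d)     ≡⟨ spread k q (g m) (u m) d ⟩
          c q * g m + d * (k * u m)     ∎
          where
          regroup : ∀ q C k u → q * C * (k * u) ≡ k * (q * C * u)
          regroup = solve-∀
          spread : ∀ k q g u d → k * ((q * g + u) * d) ≡ q * (k * d) * g + d * (k * u)
          spread = solve-∀
        bound : ∀ m → M ⊔ K ≤ m → RatioBound q C (k * d) (a m) (u m)
        bound m M⊔K≤m = begin
          q * C * u m                     ≤⟨ x≤y m (≤-trans (m≤m⊔n M K) M⊔K≤m) ⟩
          c q * a m + d * u m + K * t m   ≤⟨ +-monoʳ-≤ _ (absorb K m (≤-trans (m≤n⊔m M K) M⊔K≤m)) ⟩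
          c q * a m + d * u m + u m       ≡⟨ collect (c q) (a m) d (u m) ⟩
          c q * a m + suc d * u m         ≤⟨ +-monoʳ-≤ (c q * a m) (*-monoˡ-≤ (u m) 1+d≤kd) ⟩
          c q * a m + k * d * u m         ≡⟨ factor q (a m) (k * d) (u m) ⟩
          (q * a m + u m) * (k * d)       ∎
          where
          collect : ∀ c a d u → c * a + d * u + u ≡ c * a + suc d * u
          collect = solve-∀
          factor : ∀ q a e u → q * e * a + e * u ≡ (q * a + u) * e
          factor = solve-∀

    sandwich : a / u ⟶ C / (k * d)
    sandwich q = eventually-× (upper q) (lower q)

  #syt : ℕ → ℕ
  #syt m = paths m []

  #syt-recurrence : RecurrentWith (λ _ → 0) #syt
  #syt-recurrence = recurrent λ m → paths-recurrence (suc m) [] (λ _ → z≤n)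

  #syt-offset-recurrence : ∀ k → RecurrentWith (λ m → k * #syt (m + k)) (λ m → #syt (m + k))
  #syt-offset-recurrence k = recurrent λ m →
    trans (recurrence #syt-recurrence (m + k)) (rearrange (#syt (suc (m + k))) m k (#syt (m + k)))
    where
    rearrange : ∀ x m k y → x + suc (m + k) * y + 0 ≡ x + suc m * y + k * y
    rearrange = solve-∀

  #syt-positive : ∀ m → 1 ≤ #syt m
  #syt-positive m = paths-positive m []

  #syt-monotone : ∀ j m → #syt m ≤ #syt (j + m)
  #syt-monotone zero    m = ≤-refl
  #syt-monotone (suc j) m = ≤-trans (#syt-monotone j m) (step (j + m))
    where
    step : ∀ n → #syt n ≤ #syt (suc n)
    step zero    = ≤-refl
    step (suc n) = subst (#syt (suc n) ≤_) (sym (recurrence #syt-recurrence n))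
                         (≤-trans (m≤m+n _ _) (m≤m+n _ 0))

  #syt-grows : ∀ k m → suc m * #syt m ≤ #syt (m + suc (suc k))
  #syt-grows k m = begin
    suc m * #syt m                              ≤⟨ m≤n+m _ (#syt (suc m)) ⟩
    #syt (suc m) + suc m * #syt m               ≤⟨ m≤m+n _ 0 ⟩
    #syt (suc m) + suc m * #syt m + 0           ≡⟨ recurrence #syt-recurrence m ⟨
    #syt (suc (suc m))                          ≤⟨ #syt-monotone k (suc (suc m)) ⟩
    #syt (k + suc (suc m))                      ≡⟨ cong #syt (swap k m) ⟩
    #syt (m + suc (suc k))                      ∎
    where
    open ≤-Reasoning
    swap : ∀ k m → k + suc (suc m) ≡ m + suc (suc k)
    swap = solve-∀

  IsPartitionOf : ℕ → List ℕ → Set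
  IsPartitionOf k s = IsPartition s × sum s ≡ k

  IsPartitionOf-0 : ∀ {s} → IsPartitionOf 0 s → s ≡ []
  IsPartitionOf-0 {[]}    _ = refl
  IsPartitionOf-0 {x ∷ s} ((_ , 0<x ∷ _) , Σs≡0) = ⊥-elim (<-irrefl (sym (m+n≡0⇒m≡0 x Σs≡0)) 0<x)

  IsPartitionOf-1 : ∀ {s} → IsPartitionOf 1 s → s ≡ 1 ∷ []
  IsPartitionOf-1 {[]}                   (_ , ())
  IsPartitionOf-1 {zero ∷ s}             ((_ , () ∷ _) , _)
  IsPartitionOf-1 {suc zero ∷ []}        _ = refl
  IsPartitionOf-1 {suc zero ∷ zero ∷ s}  ((_ , _ ∷ () ∷ _) , _)
  IsPartitionOf-1 {suc zero ∷ suc y ∷ s} (_ , ())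
  IsPartitionOf-1 {suc (suc x) ∷ s}      (_ , ())

  Positive-removeCell : ∀ j s → All (0 <_) s → Removable s j → All (0 <_) (removeCell j s)
  Positive-removeCell j       []                 _                _ = []
  Positive-removeCell zero    (suc zero ∷ [])    _                _ = []
  Positive-removeCell zero    (suc zero ∷ y ∷ s) (_ ∷ 0<y ∷ _)    r = ⊥-elim (<⇒≱ 0<y (≤-pred r))
  Positive-removeCell zero    (suc (suc x) ∷ s)  (_ ∷ pos)        _ = z<s ∷ pos
  Positive-removeCell (suc j) (x ∷ s)            (0<x ∷ pos)      r = 0<x ∷ Positive-removeCell j s pos r

  sum-removeCell : ∀ j s → Removable s j → suc (sum (removeCell j s)) ≡ sum s
  sum-removeCell j       []                 ()
  sum-removeCell zero    (suc zero ∷ [])    _ = refl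
  sum-removeCell zero    (suc zero ∷ y ∷ s) _ = refl
  sum-removeCell zero    (suc (suc x) ∷ s)  _ = refl
  sum-removeCell (suc j) (x ∷ s)            r = trans (sym (+-suc x _)) (cong (x +_) (sum-removeCell j s r))

  IsPartitionOf-removeCell : ∀ {k s} j → IsPartitionOf (suc k) s → Removable s j → IsPartitionOf k (removeCell j s)
  IsPartitionOf-removeCell {k} {s} j ((dec , pos) , Σs≡1+k) r =
    (Decreasing-removeCell s j dec r , Positive-removeCell j s pos r) ,
    suc-injective (trans (sum-removeCell j s r) Σs≡1+k)

  PathsLimit : ℕ → List ℕ → Set
  PathsLimit k s = (λ m → paths m s) / (λ m → #syt (m + k)) ⟶ shapeCount k s / k !

  paths-limit-step : ∀ k s → IsPartitionOf (suc (suc k)) s →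
    (∀ σ → IsPartitionOf (suc k) σ → PathsLimit (suc k) σ) → PathsLimit (suc (suc k)) s
  paths-limit-step k s p@((dec , _) , _) IH =
    subst (λ C → (λ m → paths m s) / (λ m → #syt (m + suc (suc k))) ⟶ C / suc (suc k) !)
          (sym (shapeCount-recurrence (suc k) s dec))
          (Sandwich.sandwich {k = suc (suc k)} (s≤s (s≤s z≤n)) (1≤n! (suc k))
            (recurrent λ m → paths-recurrence (suc m) s dec) (#syt-offset-recurrence (suc (suc k)))
            #syt-recurrence #syt-positive (#syt-grows k) down⟶)
    where
    below⟶ : ∀ j → Removable s j → (λ m → paths (suc m) (removeCell j s)) / (λ m → #syt (m + suc (suc k)))
                                       ⟶ shapeCount (suc k) (removeCell j s) / suc k !
    below⟶ j r = ⟶-cong (λ m → cong #syt (sym (+-suc m (suc k))))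
                         (⟶-shift (IH (removeCell j s) (IsPartitionOf-removeCell j p r)))
    down⟶ : (λ m → down (paths (suc m)) s) / (λ m → #syt (m + suc (suc k)))
              ⟶ down (shapeCount (suc k)) s / suc k !
    down⟶ = ⟶-∑ (length s) λ j _ → ⟶-when (removable? s j) (below⟶ j)

  paths-limit : ∀ k s → IsPartitionOf k s → PathsLimit k s
  paths-limit zero s p rewrite IsPartitionOf-0 p =
    ⟶-exact λ m → trans (*-identityʳ _) (sym (trans (+-identityʳ _) (cong #syt (+-identityʳ m))))
  paths-limit (suc zero) s p rewrite IsPartitionOf-1 p =
    ⟶-exact λ m → begin
      paths m (1 ∷ []) * 1  ≡⟨ *-identityʳ _ ⟩
      paths m (1 ∷ [])      ≡⟨ +-identityʳ _ ⟨
      #syt (1 + m)          ≡⟨ cong #syt (+-comm 1 m) ⟩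
      #syt (m + 1)          ≡⟨ *-identityˡ _ ⟨
      1 * #syt (m + 1)      ∎
    where open ≡-Reasoning
  paths-limit (suc (suc k)) s p = paths-limit-step k s p (paths-limit (suc k))

  AllEntries : (ℕ → Set) → Tableau → Set
  AllEntries P U = All (All P) U

  entry-bounds : ∀ {n U x} → IsSYT n U → x ∈ concat U → 1 ≤ x × x ≤ n
  entry-bounds S x∈U with ∈-map⁻ suc (∈-resp-↭ (IsSYT.entries S) x∈U)
  ... | y , y<n , refl = s≤s z≤n , ∈-upTo⁻ y<n

  ∈-entries : ∀ {n U x} → IsSYT n U → 1 ≤ x → x ≤ n → x ∈ concat U
  ∈-entries {x = suc y} S _ x≤n = ∈-resp-↭ (↭-sym (IsSYT.entries S)) (∈-map⁺ suc (∈-upTo⁺ x≤n))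

  entries-unique : ∀ {n U} → IsSYT n U → Unique (concat U)
  entries-unique {n} S = PermutationSetoid.Unique-resp-↭ (setoid ℕ) (↭⇒↭ₛ (↭-sym (IsSYT.entries S)))
                                                     (Unique.map⁺ suc-injective (Unique.upTo⁺ n))

  entries-≤ : ∀ {n U} → IsSYT n U → AllEntries (_≤ n) U
  entries-≤ S = All.concat⁻ (All.tabulate (proj₂ ∘ entry-bounds S))

  entries-≥1 : ∀ {n U} → IsSYT n U → AllEntries (1 ≤_) U
  entries-≥1 S = All.concat⁻ (All.tabulate (proj₁ ∘ entry-bounds S))

  addEntry : ℕ → ℕ → Tableau → Tableau
  addEntry zero    v []      = (v ∷ []) ∷ []
  addEntry zero    v (r ∷ U) = (r ∷ʳ v) ∷ U
  addEntry (suc i) v []      = [] ∷ addEntry i v []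
  addEntry (suc i) v (r ∷ U) = r ∷ addEntry i v U

  length-∷ʳ : ∀ (r : List ℕ) v → length (r ∷ʳ v) ≡ suc (length r)
  length-∷ʳ []      v = refl
  length-∷ʳ (x ∷ r) v = cong suc (length-∷ʳ r v)

  shape-addEntry : ∀ i v U → shape (addEntry i v U) ≡ addCell i (shape U)
  shape-addEntry zero    v []      = refl
  shape-addEntry zero    v (r ∷ U) = cong (_∷ shape U) (length-∷ʳ r v)
  shape-addEntry (suc i) v []      = cong (0 ∷_) (shape-addEntry i v [])
  shape-addEntry (suc i) v (r ∷ U) = cong (length r ∷_) (shape-addEntry i v U)

  addCell-injective : ∀ i j σ → addCell i σ ≡ addCell j σ → i ≡ j
  addCell-injective i j σ eq with i ≟ j
  ... | yes i≡j = i≡j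
  ... | no  i≢j = ⊥-elim (1+n≢n (begin
    suc (row σ i)         ≡⟨ row-addCell-same i σ ⟨
    row (addCell i σ) i   ≡⟨ cong (λ τ → row τ i) eq ⟩
    row (addCell j σ) i   ≡⟨ row-addCell-other j σ i≢j ⟩
    row σ i               ∎))
    where open ≡-Reasoning

  addEntry-injective : ∀ i j v U → addEntry i v U ≡ addEntry j v U → i ≡ j
  addEntry-injective i j v U eq =
    addCell-injective i j (shape U) (trans (sym (shape-addEntry i v U)) (trans (cong shape eq) (shape-addEntry j v U)))

  length-shape : ∀ U → length (shape U) ≡ length U
  length-shape = length-map length

  Addable⇒≤rows : ∀ U i → Addable (shape U) i → i ≤ length U
  Addable⇒≤rows U i a = subst (i ≤_) (length-shape U) (Addable⇒≤length (shape U) i a)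

  Addable-tail : ∀ σ x i → Addable (x ∷ σ) (suc i) → Addable σ i
  Addable-tail σ x zero    _ = tt
  Addable-tail σ x (suc i) a = a

  NonEmpty-addEntry : ∀ i v U → All NonEmpty U → Addable (shape U) i → All NonEmpty (addEntry i v U)
  NonEmpty-addEntry zero    v []             _         _ = tt ∷ []
  NonEmpty-addEntry zero    v ([] ∷ U)       (() ∷ _)  _
  NonEmpty-addEntry zero    v ((x ∷ r) ∷ U)  (_ ∷ ne)  _ = tt ∷ ne
  NonEmpty-addEntry (suc i) v []             _         ()
  NonEmpty-addEntry (suc i) v (r ∷ U)        (p ∷ ne)  a =
    p ∷ NonEmpty-addEntry i v U ne (Addable-tail (shape U) (length r) i a)

  Linked-∷ʳ : ∀ {r : List ℕ} {v} → Linked _<_ r → All (_< v) r → Linked _<_ (r ∷ʳ v)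
  Linked-∷ʳ []         []         = [-]
  Linked-∷ʳ [-]        (x<v ∷ []) = x<v ∷ [-]
  Linked-∷ʳ (x<y ∷ l)  (_ ∷ <v)   = x<y ∷ Linked-∷ʳ l <v

  rowsInc-addEntry : ∀ {n} i U → All (Linked _<_) U → AllEntries (_≤ n) U → All (Linked _<_) (addEntry i (suc n) U)
  rowsInc-addEntry zero    []      _        _        = [-] ∷ []
  rowsInc-addEntry zero    (r ∷ U) (l ∷ ls) (≤n ∷ _) = Linked-∷ʳ l (All.map s≤s ≤n) ∷ ls
  rowsInc-addEntry (suc i) []      _        _        = [] ∷ rowsInc-addEntry i [] [] []
  rowsInc-addEntry (suc i) (r ∷ U) (l ∷ ls) (_ ∷ ≤n) = l ∷ rowsInc-addEntry i U ls ≤n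

  ColInc-++ : ∀ (r s t : List ℕ) → ColInc r s → ColInc (r ++ t) s
  ColInc-++ r       []      t _       = tt
  ColInc-++ (a ∷ r) (b ∷ s) t (a<b , c) = a<b , ColInc-++ r s t c

  ColInc-∷ʳ : ∀ (r s : List ℕ) v → ColInc r s → length s < length r → All (_< v) r → ColInc r (s ∷ʳ v)
  ColInc-∷ʳ (a ∷ r) []      v _         _         (a<v ∷ _) = a<v , tt
  ColInc-∷ʳ (a ∷ r) (b ∷ s) v (a<b , c) (s≤s l<l) (_ ∷ <v)  = a<b , ColInc-∷ʳ r s v c l<l <v

  colsInc-addEntry : ∀ {n} i U → Linked ColInc U → All NonEmpty U → AllEntries (_≤ n) U → Addable (shape U) i →
    Linked ColInc (addEntry i (suc n) U)
  colsInc-addEntry zero    []            _       _        _        _ = [-]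
  colsInc-addEntry zero    (r ∷ [])      _       _        _        _ = [-]
  colsInc-addEntry {n} zero (r ∷ s ∷ U)  (c ∷ l) _        _        _ = ColInc-++ r s (suc n ∷ []) c ∷ l
  colsInc-addEntry (suc i) []            _       _        _        ()
  colsInc-addEntry (suc zero) ((a ∷ r) ∷ []) _   _        ((a≤n ∷ _) ∷ _) _ = (s≤s a≤n , tt) ∷ [-]
  colsInc-addEntry (suc (suc i)) (r ∷ []) _      _        _        ()
  colsInc-addEntry {n} (suc zero) (r ∷ s ∷ U) (c ∷ l) (_ ∷ ne) (≤n ∷ ≤ns) a =
    ColInc-∷ʳ r s (suc n) c a (All.map s≤s ≤n) ∷ colsInc-addEntry zero (s ∷ U) l ne ≤ns tt
  colsInc-addEntry (suc (suc i)) (r ∷ s ∷ U) (c ∷ l) (_ ∷ ne) (_ ∷ ≤ns) a =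
    c ∷ colsInc-addEntry (suc i) (s ∷ U) l ne ≤ns a

  concat-addEntry : ∀ i v U → i ≤ length U → concat (addEntry i v U) ↭ concat U ∷ʳ v
  concat-addEntry zero    v []      _ = ↭-refl
  concat-addEntry zero    v (r ∷ U) _ = ↭-trans (↭-reflexive (++-assoc r (v ∷ []) (concat U)))
    (↭-trans (++⁺ˡ r (++-comm (v ∷ []) (concat U))) (↭-reflexive (sym (++-assoc r (concat U) (v ∷ [])))))
  concat-addEntry (suc i) v (r ∷ U) (s≤s i≤l) =
    ↭-trans (++⁺ˡ r (concat-addEntry i v U i≤l)) (↭-reflexive (sym (++-assoc r (concat U) (v ∷ []))))

  IsSYT-addEntry : ∀ {n U i} → IsSYT n U → Addable (shape U) i → IsSYT (suc n) (addEntry i (suc n) U)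
  IsSYT-addEntry {n} {U} {i} S a = record
    { rowsNonEmpty = NonEmpty-addEntry i (suc n) U (IsSYT.rowsNonEmpty S) a
    ; rowsInc      = rowsInc-addEntry i U (IsSYT.rowsInc S) (entries-≤ S)
    ; colsInc      = colsInc-addEntry i U (IsSYT.colsInc S) (IsSYT.rowsNonEmpty S) (entries-≤ S) a
    ; entries      = ↭-trans (concat-addEntry i (suc n) U (Addable⇒≤rows U i a))
                       (↭-trans (++⁺ʳ (suc n ∷ []) (IsSYT.entries S))
                         (↭-reflexive (trans (sym (map-++ suc (upTo n) (n ∷ []))) (cong (map suc) (upTo-∷ʳ n)))))
    }

  -- restrict k U unfolds to filter nonEmpty? (map (truncateRow k) U).
  truncateRow : ℕ → List ℕ → List ℕ
  truncateRow k = filter (_≤? k)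

  nonEmpty? : (r : List ℕ) → Dec (1 ≤ length r)
  nonEmpty? r = 1 ≤? length r

  truncateRow-large : ∀ k v → ¬ v ≤ k → truncateRow k (v ∷ []) ≡ []
  truncateRow-large k v v≰k = filter-reject (_≤? k) v≰k

  restrict-addEntry : ∀ k v → ¬ v ≤ k → ∀ i U → i ≤ length U → restrict k (addEntry i v U) ≡ restrict k U
  restrict-addEntry k v v≰k zero [] _ rewrite truncateRow-large k v v≰k = refl
  restrict-addEntry k v v≰k zero (r ∷ U) _
    rewrite filter-++ (_≤? k) r (v ∷ []) | truncateRow-large k v v≰k | ++-identityʳ (truncateRow k r) = refl
  restrict-addEntry k v v≰k (suc i) (r ∷ U) (s≤s i≤l) =
    filter-∷-cong nonEmpty? (truncateRow k r) (restrict-addEntry k v v≰k i U i≤l)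

  restrict-self : ∀ k U → AllEntries (_≤ k) U → All NonEmpty U → restrict k U ≡ U
  restrict-self k []            _        _          = refl
  restrict-self k ((x ∷ r) ∷ U) (≤k ∷ ≤ks) (_ ∷ ne) rewrite filter-all (_≤? k) ≤k =
    cong ((x ∷ r) ∷_) (restrict-self k U ≤ks ne)

  restrict-zero : ∀ U → AllEntries (1 ≤_) U → restrict 0 U ≡ []
  restrict-zero []      _          = refl
  restrict-zero (r ∷ U) (≥1 ∷ ≥1s) rewrite filter-none (_≤? 0) (All.map <⇒≱ ≥1) = restrict-zero U ≥1s

  ColInc-trans : ∀ {r s t : List ℕ} → ColInc r s → ColInc s t → ColInc r t
  ColInc-trans {t = []}                              _         _         = tt
  ColInc-trans {a ∷ r} {b ∷ s} {c ∷ t} (a<b , rs) (b<c , st) = <-trans a<b b<c , ColInc-trans rs st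

  head-below : ∀ {a} {r : List ℕ} → Linked _<_ (a ∷ r) → All (a <_) r
  head-below [-]       = []
  head-below (a<b ∷ l) = Linked.Linked⇒All <-trans a<b l

  ColInc-truncateRow : ∀ k (r s : List ℕ) → Linked _<_ s → ColInc r s → ColInc (truncateRow k r) (truncateRow k s)
  ColInc-truncateRow k r       []      _ _ = tt
  ColInc-truncateRow k (a ∷ r) (b ∷ s) l (a<b , c) with b ≤? k
  ... | yes b≤k rewrite filter-accept (_≤? k) {xs = r} (≤-trans (<⇒≤ a<b) b≤k)
                      | filter-accept (_≤? k) {xs = s} b≤k = a<b , ColInc-truncateRow k r s (Linked.tail l) c
  ... | no  b≰k rewrite filter-none (_≤? k) {xs = b ∷ s}
                          (b≰k ∷ All.map (λ b<x x≤k → b≰k (≤-trans (<⇒≤ b<x) x≤k)) (head-below l)) = tt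

  colsInc-truncate : ∀ k V → Linked ColInc V → All (Linked _<_) V → Linked ColInc (map (truncateRow k) V)
  colsInc-truncate k []          _       _             = []
  colsInc-truncate k (r ∷ [])    _       _             = [-]
  colsInc-truncate k (r ∷ s ∷ V) (c ∷ l) (_ ∷ ls ∷ lss) =
    ColInc-truncateRow k r s ls c ∷ colsInc-truncate k (s ∷ V) l (ls ∷ lss)

  concat-filter-nonEmpty : ∀ W → concat (filter nonEmpty? W) ≡ concat W
  concat-filter-nonEmpty []            = refl
  concat-filter-nonEmpty ([] ∷ W)      = concat-filter-nonEmpty W
  concat-filter-nonEmpty ((a ∷ r) ∷ W) = cong ((a ∷ r) ++_) (concat-filter-nonEmpty W)

  concat-truncate : ∀ k V → concat (map (truncateRow k) V) ≡ truncateRow k (concat V)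
  concat-truncate k []      = refl
  concat-truncate k (r ∷ V) =
    trans (cong (truncateRow k r ++_) (concat-truncate k V)) (sym (filter-++ (_≤? k) r (concat V)))

  truncate-entries : ∀ n k → k ≤ n → truncateRow k (map suc (upTo n)) ≡ map suc (upTo k)
  truncate-entries n k k≤n with m≤n⇒m<n∨m≡n k≤n
  ... | inj₂ refl = filter-all (_≤? k) (All.tabulate λ x∈ →
    let y , y<k , x≡1+y = ∈-map⁻ suc x∈ in subst (_≤ k) (sym x≡1+y) (∈-upTo⁻ y<k))
  truncate-entries (suc n) k _ | inj₁ (s≤s k≤n) = begin
    truncateRow k (map suc (upTo (suc n)))                   ≡⟨ cong (truncateRow k ∘ map suc) (upTo-∷ʳ n) ⟨
    truncateRow k (map suc (upTo n ∷ʳ n))                    ≡⟨ cong (truncateRow k) (map-++ suc (upTo n) (n ∷ [])) ⟩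
    truncateRow k (map suc (upTo n) ∷ʳ suc n)                ≡⟨ filter-++ (_≤? k) (map suc (upTo n)) (suc n ∷ []) ⟩
    truncateRow k (map suc (upTo n)) ++ truncateRow k (suc n ∷ [])
      ≡⟨ cong₂ _++_ (truncate-entries n k k≤n) (truncateRow-large k (suc n) (<⇒≱ (s≤s k≤n))) ⟩
    map suc (upTo k) ++ []                                   ≡⟨ ++-identityʳ _ ⟩
    map suc (upTo k)                                         ∎
    where open ≡-Reasoning

  IsSYT-restrict : ∀ {n V k} → IsSYT n V → k ≤ n → IsSYT k (restrict k V)
  IsSYT-restrict {n} {V} {k} S k≤n = record
    { rowsNonEmpty = All.map nonEmpty (All.all-filter nonEmpty? (map (truncateRow k) V))
    ; rowsInc      = All.filter⁺ nonEmpty? (All.map⁺ (All.map (Linked.filter⁺ (_≤? k) <-trans) (IsSYT.rowsInc S)))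
    ; colsInc      = Linked.filter⁺ nonEmpty? ColInc-trans (colsInc-truncate k V (IsSYT.colsInc S) (IsSYT.rowsInc S))
    ; entries      = ↭-trans
                       (↭-reflexive (trans (concat-filter-nonEmpty (map (truncateRow k) V)) (concat-truncate k V)))
                       (↭-trans (filter-↭ (_≤? k) (IsSYT.entries S)) (↭-reflexive (truncate-entries n k k≤n)))
    }
    where
    nonEmpty : ∀ {r : List ℕ} → 1 ≤ length r → NonEmpty r
    nonEmpty {_ ∷ _} _ = tt

  ColInc-length : ∀ {r s : List ℕ} → ColInc r s → length s ≤ length r
  ColInc-length {r}     {[]}    _       = z≤n
  ColInc-length {a ∷ r} {b ∷ s} (_ , c) = s≤s (ColInc-length c)

  Decreasing-shape : ∀ V → Linked ColInc V → Decreasing (shape V)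
  Decreasing-shape []          _       _       = z≤n
  Decreasing-shape (r ∷ [])    _       zero    = z≤n
  Decreasing-shape (r ∷ [])    _       (suc x) = z≤n
  Decreasing-shape (r ∷ s ∷ V) (c ∷ l) zero    = ColInc-length c
  Decreasing-shape (r ∷ s ∷ V) (c ∷ l) (suc x) = Decreasing-shape (s ∷ V) l x

  IsSYT⇒IsPartition : ∀ {n V} → IsSYT n V → IsPartition (shape V)
  IsSYT⇒IsPartition {V = V} S = Decreasing-shape V (IsSYT.colsInc S) , positive V (IsSYT.rowsNonEmpty S)
    where
    positive : ∀ V → All NonEmpty V → All (0 <_) (shape V)
    positive []            []       = []
    positive ((_ ∷ _) ∷ V) (_ ∷ ne) = z<s ∷ positive V ne

  largest-last : ∀ n (r : List ℕ) → Linked _<_ r → All (_≤ suc n) r → suc n ∈ r → r ≡ truncateRow n r ∷ʳ suc n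
  largest-last n (a ∷ [])    _         _           (here refl) rewrite truncateRow-large n (suc n) (<-irrefl refl) = refl
  largest-last n (a ∷ b ∷ r) (a<b ∷ _) (_ ∷ b≤ ∷ _) (here refl) = ⊥-elim (<⇒≱ a<b b≤)
  largest-last n (a ∷ r)     l         (a≤ ∷ ≤s)   (there m) with a ≟ suc n
  ... | yes refl = ⊥-elim (<⇒≱ (All.lookup (head-below l) m) (All.lookup ≤s m))
  ... | no  a≢ rewrite filter-accept (_≤? n) {xs = r} (≤-pred (≤∧≢⇒< a≤ a≢)) =
    cong (a ∷_) (largest-last n r (Linked.tail l) ≤s m)

  ≤-without-largest : ∀ n (r : List ℕ) → All (_≤ suc n) r → suc n ∉ r → All (_≤ n) r
  ≤-without-largest n r ≤1+n 1+n∉r =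
    All.tabulate λ {x} x∈r →
      ≤-pred (≤∧≢⇒< (All.lookup ≤1+n x∈r) λ x≡1+n → 1+n∉r (subst (_∈ r) x≡1+n x∈r))

  largest-in-first-row : ∀ n r V → Linked _<_ r → All (_≤ suc n) r → suc n ∈ r → restrict n V ≡ V →
    AllEntries (_≤ suc n) V → All NonEmpty V → Linked ColInc (r ∷ V) →
    r ∷ V ≡ addEntry 0 (suc n) (restrict n (r ∷ V))
  largest-in-first-row n r V l ≤r max∈r V-kept ≤V ne c with truncateRow n r in eq | largest-last n r l ≤r max∈r
  ... | a ∷ w | r≡ rewrite V-kept = cong (_∷ V) r≡
  ... | []    | r≡ rewrite V-kept =
    trans (cong (_∷ V) r≡) (first-row-alone V ≤V ne (subst (λ r → Linked ColInc (r ∷ V)) r≡ c))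
    where
    first-row-alone : ∀ V → AllEntries (_≤ suc n) V → All NonEmpty V → Linked ColInc ((suc n ∷ []) ∷ V) →
      (suc n ∷ []) ∷ V ≡ addEntry 0 (suc n) V
    first-row-alone []            _                  _        _               = refl
    first-row-alone ([] ∷ V)      _                  (() ∷ _) _
    first-row-alone ((b ∷ s) ∷ V) ((b≤ ∷ _) ∷ _)     _        ((1+n<b , _) ∷ _) = ⊥-elim (<⇒≱ 1+n<b b≤)

  decompose-rows : ∀ n V → All (Linked _<_) V → AllEntries (_≤ suc n) V → All NonEmpty V → Linked ColInc V →
    suc n ∈ concat V → Unique (concat V) → Σ ℕ λ i → V ≡ addEntry i (suc n) (restrict n V)
  decompose-rows n ([] ∷ V)      _        _          (() ∷ _) _ _ _
  decompose-rows n ((a ∷ r) ∷ V) (l ∷ ls) (≤r ∷ ≤V) (_ ∷ ne) c max∈ uniq with suc n ∈? (a ∷ r)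
  ... | yes max∈r = 0 , largest-in-first-row n (a ∷ r) V l ≤r max∈r V-kept ≤V ne c
    where
    V-kept : restrict n V ≡ V
    V-kept = restrict-self n V (All.concat⁻ (≤-without-largest n (concat V) (All.concat⁺ ≤V) (max∉V))) ne
      where
      max∉V : suc n ∉ concat V
      max∉V = Unique-++-disjoint (a ∷ r) uniq max∈r
  ... | no  max∉r
    with decompose-rows n V ls ≤V ne (Linked.tail c) (max∈V (∈-++⁻ (a ∷ r) max∈)) (Unique-++⁻ʳ (a ∷ r) uniq)
    where
    max∈V : _ → suc n ∈ concat V
    max∈V (inj₁ max∈r) = ⊥-elim (max∉r max∈r)
    max∈V (inj₂ max∈V) = max∈V
  ...   | i , V≡ rewrite filter-all (_≤? n) (≤-without-largest n (a ∷ r) ≤r max∉r) =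
    suc i , cong ((a ∷ r) ∷_) V≡

  Addable-of-Decreasing : ∀ σ i → Decreasing (addCell i σ) → Addable σ i
  Addable-of-Decreasing σ zero    _   = tt
  Addable-of-Decreasing σ (suc i) dec =
    subst₂ _≤_ (row-addCell-same (suc i) σ) (row-addCell-other (suc i) σ (λ i≡1+i → <-irrefl i≡1+i (n<1+n i)))
               (dec i)

  decompose : ∀ {n V} → IsSYT (suc n) V →
    Σ ℕ λ i → V ≡ addEntry i (suc n) (restrict n V) × Addable (shape (restrict n V)) i
  decompose {n} {V} S with decompose-rows n V (IsSYT.rowsInc S) (entries-≤ S) (IsSYT.rowsNonEmpty S) (IsSYT.colsInc S)
                                              (∈-entries S (s≤s z≤n) ≤-refl) (entries-unique S)
  ... | i , V≡ = i , V≡ , Addable-of-Decreasing (shape (restrict n V)) i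
    (subst Decreasing (trans (cong shape V≡) (shape-addEntry i (suc n) (restrict n V))) (proj₁ (IsSYT⇒IsPartition S)))

  addableRows : List ℕ → List ℕ
  addableRows σ = filter (addable? σ) (upTo (suc (length σ)))

  ∈-addableRows⁻ : ∀ σ {i} → i ∈ addableRows σ → Addable σ i
  ∈-addableRows⁻ σ i∈ = proj₂ (∈-filter⁻ (addable? σ) {xs = upTo (suc (length σ))} i∈)

  ∈-addableRows⁺ : ∀ σ {i} → Addable σ i → i ∈ addableRows σ
  ∈-addableRows⁺ σ {i} a = ∈-filter⁺ (addable? σ) (∈-upTo⁺ (s≤s (Addable⇒≤length σ i a))) a

  sum-addableRows : ∀ σ (f : ℕ → ℕ) →
    sum (map f (addableRows σ)) ≡ ∑[ i < suc (length σ) ] when (addable? σ i) (f i)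
  sum-addableRows σ f = trans (sum-map-filter (addable? σ) f (upTo (suc (length σ))))
                              (sum-map-applyUpTo (λ i → i) (λ i → when (addable? σ i) (f i)) (suc (length σ)))

  children : ℕ → Tableau → List Tableau
  children v W = map (λ i → addEntry i v W) (addableRows (shape W))

  extensions : ℕ → ℕ → Tableau → List Tableau
  extensions zero    c U = U ∷ []
  extensions (suc m) c U = concatMap (children (suc (c + m))) (extensions m c U)

  private
    1+c+m≰c : ∀ c m → ¬ suc (c + m) ≤ c
    1+c+m≰c c m 1+c+m≤c = <-irrefl refl (≤-trans 1+c+m≤c (m≤m+n c m))

  ∈-children⁻ : ∀ {v W V} → V ∈ children v W → Σ ℕ λ i → Addable (shape W) i × V ≡ addEntry i v W
  ∈-children⁻ {v} {W} V∈ with ∈-map⁻ (λ i → addEntry i v W) V∈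
  ... | i , i∈ , V≡ = i , ∈-addableRows⁻ (shape W) i∈ , V≡

  extensions-sound : ∀ m c U V → IsSYT c U → V ∈ extensions m c U → IsSYT (c + m) V × restrict c V ≡ U
  extensions-sound zero c U V S (here refl) =
    subst (λ n → IsSYT n V) (sym (+-identityʳ c)) S , restrict-self c V (entries-≤ S) (IsSYT.rowsNonEmpty S)
  extensions-sound (suc m) c U V S V∈ with ∈-concatMap⁻′ (children (suc (c + m))) (extensions m c U) V∈
  ... | W , W∈ , V∈children with ∈-children⁻ V∈children | extensions-sound m c U W S W∈
  ...   | i , a , refl | W-syt , W↾≡U =
    subst (λ n → IsSYT n V) (sym (+-suc c m)) (IsSYT-addEntry W-syt a) ,
    trans (restrict-addEntry c (suc (c + m)) (1+c+m≰c c m) i W (Addable⇒≤rows W i a)) W↾≡U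

  extensions-complete : ∀ m c U V → IsSYT c U → IsSYT (c + m) V → restrict c V ≡ U → V ∈ extensions m c U
  extensions-complete zero c U V S V-syt V↾≡U =
    here (trans (sym (restrict-self c V (entries-≤ V-syt′) (IsSYT.rowsNonEmpty V-syt′))) V↾≡U)
    where V-syt′ = subst (λ n → IsSYT n V) (+-identityʳ c) V-syt
  extensions-complete (suc m) c U V S V-syt V↾≡U with decompose (subst (λ n → IsSYT n V) (+-suc c m) V-syt)
  ... | i , V≡ , a = ∈-concatMap⁺ (children (suc (c + m))) (lose W∈ V∈children)
    where
    W = restrict (c + m) V
    W↾≡U : restrict c W ≡ U
    W↾≡U = trans (sym (restrict-addEntry c (suc (c + m)) (1+c+m≰c c m) i W (Addable⇒≤rows W i a)))
                 (trans (cong (restrict c) (sym V≡)) V↾≡U)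
    W∈ : W ∈ extensions m c U
    W∈ = extensions-complete m c U W S (IsSYT-restrict (subst (λ n → IsSYT n V) (+-suc c m) V-syt) (n≤1+n _)) W↾≡U
    V∈children : V ∈ children (suc (c + m)) W
    V∈children = subst (_∈ children (suc (c + m)) W) (sym V≡) (∈-map⁺ _ (∈-addableRows⁺ (shape W) a))

  extensions-unique : ∀ m c U → IsSYT c U → Unique (extensions m c U)
  extensions-unique zero    c U S = [] ∷ []
  extensions-unique (suc m) c U S =
    Unique-concatMap (children (suc (c + m))) (restrict (c + m)) (extensions m c U) (extensions-unique m c U S)
      (λ W _ → Unique.map⁺ (addEntry-injective _ _ (suc (c + m)) W)
                           (Unique.filter⁺ (addable? (shape W)) (Unique.upTo⁺ (suc (length (shape W))))))
      parent
    where
    parent : ∀ W → W ∈ extensions m c U → ∀ V → V ∈ children (suc (c + m)) W → restrict (c + m) V ≡ W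
    parent W W∈ V V∈ with ∈-children⁻ V∈
    ... | i , a , refl =
      let W-syt = proj₁ (extensions-sound m c U W S W∈) in
      trans (restrict-addEntry (c + m) (suc (c + m)) (<-irrefl refl) i W (Addable⇒≤rows W i a))
            (restrict-self (c + m) W (entries-≤ W-syt) (IsSYT.rowsNonEmpty W-syt))

  sum-extensions : ∀ (g : List ℕ → ℕ) m c U → sum (map (g ∘ shape) (extensions m c U)) ≡ pathSum g m (shape U)
  sum-extensions g zero    c U = +-identityʳ _
  sum-extensions g (suc m) c U = begin
    sum (map (g ∘ shape) (concatMap (children (suc (c + m))) (extensions m c U)))
      ≡⟨ sum-map-concatMap (g ∘ shape) (children (suc (c + m))) (extensions m c U) ⟩
    sum (map (λ W → sum (map (g ∘ shape) (children (suc (c + m)) W))) (extensions m c U))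
      ≡⟨ cong sum (map-cong (λ W → sum-children W) (extensions m c U)) ⟩
    sum (map (up g ∘ shape) (extensions m c U))
      ≡⟨ sum-extensions (up g) m c U ⟩
    pathSum (up g) m (shape U)
      ≡⟨ pathSum-shift g m (shape U) ⟨
    pathSum g (suc m) (shape U) ∎
    where
    open ≡-Reasoning
    sum-children : ∀ W → sum (map (g ∘ shape) (children (suc (c + m)) W)) ≡ up g (shape W)
    sum-children W = begin
      sum (map (g ∘ shape) (map (λ i → addEntry i (suc (c + m)) W) (addableRows (shape W))))
        ≡⟨ cong sum (map-∘ (addableRows (shape W))) ⟨
      sum (map (λ i → g (shape (addEntry i (suc (c + m)) W))) (addableRows (shape W)))
        ≡⟨ cong sum (map-cong (λ i → cong g (shape-addEntry i (suc (c + m)) W)) (addableRows (shape W))) ⟩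
      sum (map (λ i → g (addCell i (shape W))) (addableRows (shape W)))
        ≡⟨ sum-addableRows (shape W) (λ i → g (addCell i (shape W))) ⟩
      up g (shape W) ∎

  length-extensions : ∀ m c U → length (extensions m c U) ≡ paths m (shape U)
  length-extensions m c U = trans (length≡sum-map-1 (extensions m c U)) (sum-extensions (λ _ → 1) m c U)

  HasCount-unique : ∀ {P Q : Pred Tableau _} {m n} → (∀ U → P U ⇔ Q U) → HasCount P m → HasCount Q n → m ≡ n
  HasCount-unique P⇔Q (L , length-L , unique-L , ∈L) (L′ , length-L′ , unique-L′ , ∈L′) =
    trans (sym length-L) (trans (↭-length (∼bag⇒↭ (unique∧set⇒bag unique-L unique-L′ λ {U} → same U))) length-L′)
    where
    same : ∀ U → U ∈ L ⇔ U ∈ L′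
    same U = mk⇔ (Equivalence.to (∈L′ U) ∘ Equivalence.to (P⇔Q U) ∘ Equivalence.from (∈L U))
                 (Equivalence.to (∈L U) ∘ Equivalence.from (P⇔Q U) ∘ Equivalence.from (∈L′ U))

  []-IsSYT : IsSYT 0 []
  []-IsSYT = record { rowsNonEmpty = [] ; rowsInc = [] ; colsInc = [] ; entries = ↭-refl }

  extensions-count : ∀ m c U → IsSYT c U → HasCount (λ V → IsSYT (c + m) V × restrict c V ≡ U) (paths m (shape U))
  extensions-count m c U S = extensions m c U , length-extensions m c U , extensions-unique m c U S ,
    λ V → mk⇔ (λ (V-syt , V↾≡U) → extensions-complete m c U V S V-syt V↾≡U) (extensions-sound m c U V S)

  shapeCount-count : ∀ k μ → HasCount (λ U → IsSYT k U × shape U ≡ μ) (shapeCount k μ)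
  shapeCount-count k μ =
    filter (λ W → shape W ≟ₛ μ) syt , length-filter , Unique.filter⁺ _ (extensions-unique k 0 [] []-IsSYT) ,
    λ U → mk⇔ (λ (U-syt , U-shape) → ∈-filter⁺ _ (syt-complete U U-syt) U-shape)
              (λ U∈ → let U∈syt , U-shape = ∈-filter⁻ _ {xs = syt} U∈ in
                      proj₁ (extensions-sound k 0 [] U []-IsSYT U∈syt) , U-shape)
    where
    syt = extensions k 0 []
    syt-complete : ∀ U → IsSYT k U → U ∈ syt
    syt-complete U U-syt = extensions-complete k 0 [] U []-IsSYT U-syt (restrict-zero U (entries-≥1 U-syt))
    length-filter : length (filter (λ W → shape W ≟ₛ μ) syt) ≡ shapeCount k μ
    length-filter = trans (length≡sum-map-1 (filter (λ W → shape W ≟ₛ μ) syt))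
                          (trans (sum-map-filter (λ W → shape W ≟ₛ μ) (λ _ → 1) syt) (sum-extensions (atShape μ) k 0 []))

  syt-count≡#syt : ∀ {n t} → HasCount (IsSYT n) t → t ≡ #syt n
  syt-count≡#syt {n} t-count = HasCount-unique (λ V → mk⇔ (λ V-syt → V-syt , restrict-zero V (entries-≥1 V-syt)) proj₁)
                                               t-count (extensions-count n 0 [] []-IsSYT)

  containing-count≡paths : ∀ {k T n N} → IsSYT k T → k ≤ n → HasCount (λ U → IsSYT n U × ContainsSub k T U) N →
    N ≡ paths (n ∸ k) (shape T)
  containing-count≡paths {k} {T} {n} T-syt k≤n N-count =
    HasCount-unique (λ V → mk⇔ (Product.map₁ (subst (λ m → IsSYT m V) (sym (m+[n∸m]≡n k≤n))))
                               (Product.map₁ (subst (λ m → IsSYT m V) (m+[n∸m]≡n k≤n))))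
                    N-count (extensions-count (n ∸ k) k T T-syt)

  shape-count≡shapeCount : ∀ {k μ f} → HasCount (λ U → IsSYT k U × shape U ≡ μ) f → f ≡ shapeCount k μ
  shape-count≡shapeCount {k} {μ} f-count = HasCount-unique (λ _ → mk⇔ id id) f-count (shapeCount-count k μ)

  IsSYT⇒IsPartitionOf : ∀ {k T} → IsSYT k T → IsPartitionOf k (shape T)
  IsSYT⇒IsPartitionOf {k} {T} S = IsSYT⇒IsPartition S , (begin
    sum (shape T)               ≡⟨ sum-shape T ⟩
    length (concat T)           ≡⟨ ↭-length (IsSYT.entries S) ⟩
    length (map suc (upTo k))   ≡⟨ length-map suc (upTo k) ⟩
    length (upTo k)             ≡⟨ length-upTo k ⟩
    k                           ∎)
    where
    open ≡-Reasoning
    sum-shape : ∀ T → sum (shape T) ≡ length (concat T)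
    sum-shape []      = refl
    sum-shape (r ∷ T) = trans (cong (length r +_) (sum-shape T)) (sym (length-++ r))

  ε-numerator : ∀ ε → 0ℚ ℚ.< ε → Σ ℕ λ k → ℚ.↥ ε ≡ ℤ.+ suc k
  ε-numerator (mkℚ (ℤ.+ zero) _ _)  (ℚ.*<* 0<0) = ⊥-elim (ℤ.<-irrefl refl 0<0)
  ε-numerator (mkℚ (ℤ.+ suc k) _ _) _           = k , refl
  ε-numerator (mkℚ ℤ.-[1+ _ ] _ _)  (ℚ.*<* ())

  distance-bound : ∀ q A B P → q * A ≤ q * B + P → q * B ≤ q * A + P → q * ℤ.∣ A ⊖ B ∣ ≤ P
  distance-bound q A B P qA≤ qB≤ with A ≤? B
  ... | yes A≤B rewrite ℤ.∣⊖∣-≤ A≤B = begin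
    q * (B ∸ A)         ≡⟨ *-distribˡ-∸ q B A ⟩
    q * B ∸ q * A       ≤⟨ ∸-monoˡ-≤ (q * A) qB≤ ⟩
    q * A + P ∸ q * A   ≡⟨ m+n∸m≡n (q * A) P ⟩
    P                   ∎
    where open ≤-Reasoning
  ... | no  A≰B rewrite ℤ.∣m⊖n∣≡∣n⊖m∣ A B | ℤ.∣⊖∣-≤ (≰⇒≥ A≰B) = begin
    q * (A ∸ B)         ≡⟨ *-distribˡ-∸ q A B ⟩
    q * A ∸ q * B       ≤⟨ ∸-monoˡ-≤ (q * B) qA≤ ⟩
    q * B + P ∸ q * B   ≡⟨ m+n∸m≡n (q * B) P ⟩
    P                   ∎
    where open ≤-Reasoning

  toℚᵘ-distance : ∀ a u c d →
    toℚᵘ ℚ.∣ ratio a (suc u) ℚ.- ratio c (suc d) ∣ ℚᵘ.≃ ℚᵘ.∣ mkℚᵘ (ℤ.+ a) u ℚᵘ.- mkℚᵘ (ℤ.+ c) d ∣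
  toℚᵘ-distance a u c d = ℚᵘ.≃-trans (ℚ.toℚᵘ-homo-∣-∣ (x ℚ.- y)) (ℚᵘ.∣-∣-cong (ℚᵘ.≃-trans
    (ℚ.toℚᵘ-homo-+ x (ℚ.- y))
    (ℚᵘ.+-cong (ℚ.toℚᵘ-fromℚᵘ (mkℚᵘ (ℤ.+ a) u))
               (ℚᵘ.≃-trans (ℚ.toℚᵘ-homo‿- y) (ℚᵘ.-‿cong (ℚ.toℚᵘ-fromℚᵘ (mkℚᵘ (ℤ.+ c) d)))))))
    where
    x = ratio a (suc u)
    y = ratio c (suc d)

  x*e<n : ∀ e x n → suc e * x ≤ n → 0 < n → x * e < n
  x*e<n e zero    n _       0<n = 0<n
  x*e<n e (suc x) n [1+e]x≤n _  =
    <-≤-trans (subst (_< suc e * suc x) (*-comm e (suc x)) (m<n+m (e * suc x) z<s)) [1+e]x≤n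

  -- With q = ↧ ε + 1 the bounds give |a/u - c/d| ≤ 1/q < 1/↧ ε ≤ ε.
  ratio-close : ∀ ε → 0ℚ ℚ.< ε → ∀ a u c d → 1 ≤ u → 1 ≤ d →
    RatioBound (suc (ℚ.↧ₙ ε)) a u c d → RatioBound (suc (ℚ.↧ₙ ε)) c d a u →
    ℚ.∣ ratio a u ℚ.- ratio c d ∣ ℚ.< ε
  ratio-close ε@(mkℚ _ e _) ε>0 a (suc u) c (suc d) _ _ upper lower with ε-numerator ε ε>0
  ... | k , refl = ℚ.toℚᵘ-cancel-<
    (ℚᵘ.<-respˡ-≃ (ℚᵘ.≃-sym (toℚᵘ-distance a u c d)) (*<* (subst₂ ℤ._<_ lhs rhs (ℤ.+<+ dist*e<k*UD))))
    where
    q = suc (suc e)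
    A = a * suc d
    B = c * suc u
    UD = suc u * suc d
    dist = ℤ.∣ A ⊖ B ∣
    expand : ∀ q x y z → (q * x + y) * z ≡ q * (x * z) + z * y
    expand = solve-∀
    q*dist≤UD : q * dist ≤ UD
    q*dist≤UD = distance-bound q A B UD
      (subst₂ _≤_ (*-assoc q a (suc d)) (expand q c (suc d) (suc u)) upper)
      (subst₂ _≤_ (*-assoc q c (suc u)) (trans (expand q a (suc u) (suc d)) (cong (q * A +_) (*-comm (suc d) (suc u)))) lower)
    dist*e<k*UD : dist * suc e < suc k * UD
    dist*e<k*UD = begin-strict
      dist * suc e        <⟨ x*e<n (suc e) dist UD q*dist≤UD z<s ⟩
      UD                  ≤⟨ m≤m+n UD (k * UD) ⟩
      suc k * UD          ∎
      where open ≤-Reasoning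
    numerator≡ : ℤ.+ a ℤ.* ℤ.+ suc d ℤ.+ (ℤ.- ℤ.+ c) ℤ.* ℤ.+ suc u ≡ A ⊖ B
    numerator≡ = trans
      (cong₂ ℤ._+_ (sym (ℤ.pos-* a (suc d)))
                   (trans (sym (ℤ.neg-distribˡ-* (ℤ.+ c) (ℤ.+ suc u))) (cong ℤ.-_ (sym (ℤ.pos-* c (suc u))))))
      (ℤ.m-n≡m⊖n A B)
    lhs : ℤ.+ (dist * suc e) ≡ ℤ.+ ℤ.∣ ℤ.+ a ℤ.* ℤ.+ suc d ℤ.+ (ℤ.- ℤ.+ c) ℤ.* ℤ.+ suc u ∣ ℤ.* ℤ.+ suc e
    lhs = trans (ℤ.pos-* dist (suc e)) (cong (λ w → ℤ.+ ℤ.∣ w ∣ ℤ.* ℤ.+ suc e) (sym numerator≡))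
    rhs : ℤ.+ (suc k * UD) ≡ ℤ.+ suc k ℤ.* ℤ.+ UD
    rhs = ℤ.pos-* (suc k) UD

  ratio-limit : ∀ {a u c d} → a / u ⟶ c / d → (∀ m → 1 ≤ u m) → 1 ≤ d →
    ∀ ε → 0ℚ ℚ.< ε → Eventually λ m → ℚ.∣ ratio (a m) (u m) ℚ.- ratio c d ∣ ℚ.< ε
  ratio-limit {a} {u} {c} {d} a⟶ u≥1 d≥1 ε ε>0 with a⟶ (suc (ℚ.↧ₙ ε))
  ... | M , bounds = M , λ m M≤m →
    let upper , lower = bounds m M≤m in ratio-close ε ε>0 (a m) (u m) c d (u≥1 m) d≥1 upper lower

open import Data.Nat using (ℕ; _≤_; _!; _+_; _∸_)
open import Data.Nat.Properties using (m+n≤o⇒n≤o; m+n≤o⇒m≤o∸n; m∸n+n≡m; 1≤n!)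
open import Data.Rational using (ℚ; 0ℚ; _<_; _-_; ∣_∣)
open import Data.Product using (Σ; _×_; _,_)
open import Relation.Binary.PropositionalEquality using (_≡_)
open import Function using (id)
open YoungLattice

theorem1 : (k : ℕ) (T : Tableau) → IsSYT k T →
    (N t : ℕ → ℕ) →
    (∀ n → HasCount (λ U → IsSYT n U × ContainsSub k T U) (N n)) →
    (∀ n → HasCount (IsSYT n) (t n)) →
    (f : ℕ) → HasCount (λ U → IsSYT k U × (shape U ≡ shape T)) f →
    (ε : ℚ) → 0ℚ < ε →
    Σ ℕ λ M → ∀ n → M ≤ n → ∣ ratio (N n) (t n) - ratio f (k !) ∣ < ε
theorem1 k T T-syt N t N-count t-count f f-count ε ε>0 =
  let M , close = ratio-limit limit (λ m → #syt-positive (m + k)) (1≤n! k) ε ε>0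
  in M + k , λ n M+k≤n → counted n (m+n≤o⇒n≤o M M+k≤n) (close (n ∸ k) (m+n≤o⇒m≤o∸n M M+k≤n))
  where
  limit : PathsLimit k (shape T)
  limit = paths-limit k (shape T) (IsSYT⇒IsPartitionOf T-syt)
  counted : ∀ n → k ≤ n →
    ∣ ratio (paths (n ∸ k) (shape T)) (#syt (n ∸ k + k)) - ratio (shapeCount k (shape T)) (k !) ∣ < ε →
    ∣ ratio (N n) (t n) - ratio f (k !) ∣ < ε
  counted n k≤n rewrite containing-count≡paths T-syt k≤n (N-count n) | syt-count≡#syt (t-count n)
                      | shape-count≡shapeCount f-count | m∸n+n≡m k≤n = id
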